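{- Let $P\in\{\textsf{LEV-ORD},\textsf{ASS-ORD},\textsf{ASS-R-ORD},\textsf{ANY-ORD}\}$ and $R\in\{\textsf{RED},\textsf{NO-RED}\}$. The proof system $\mathsf{QCDCL}^{P}_{R}$ is complete: every false QCNF has a $\mathsf{QCDCL}^{P}_{R}$ refutation.
   Context: QBF basics. A literal is a variable $x$ or $\bar x$; a clause is a disjunction of literals identified with its set of literals; $(\bot)$ is the empty clause. A QCNF is $\Phi=\mathcal{Q}\cdot\phi$ with prefix $\mathcal{Q}=Q_1X_1\dots Q_sX_s$ (disjoint nonempty variable sets, alternating $Q_i\in\{\exists,\forall\}$) and matrix $\phi$ a CNF of non-tautological clauses; it is false if the quantified Boolean formula evaluates to false. $\mathrm{lv}(x)=i$ if the variable of $x$ is in $X_i$; existential/universal variables are those in $\exists$/$\forall$-blocks. $\mathrm{red}(C)$ deletes from $C$ every universal literal $v$ with $\mathrm{lv}(v)>\mathrm{lv}(x)$ for all existential $x\in C$. For existential $\ell$ not occurring (as variable) in $C_1,C_2$: $(C_1\vee\ell)\otimes_\ell(C_2\vee\bar\ell)=C_1\vee C_2$. QCDCL. $C|_\sigma=\top$ if $C\cap\sigma\neq\emptyset$, else the clause of all $\ell\in C$ with $\bar\ell\notin\sigma$. A trail for $\Phi=\mathcal{Q}\cdot\phi$ is $\mathcal{T}=(p_{(0,1)},\dots,p_{(0,g_0)};d_1,p_{(1,1)},\dots,p_{(1,g_1)};\dots;d_r,p_{(r,1)},\dots,p_{(r,g_r)})$, a sequence of literals with no variable occurring twice; $d_i$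 decision literals, $p_{(i,j)}$ propagated literals (existential, or $\bot$ only as last element: a conflict). $\mathcal{T}[s,t]$: initial segment ending at $p_{(s,t)}$ (at $d_s$ if $t=0$; $\mathcal{T}[0,0]$ empty). Each $p_{(i,j)}$ has an antecedent $\mathrm{ante}(p_{(i,j)})\in\phi$ with: under RED, $\mathrm{red}(\mathrm{ante}(p_{(i,j)})|_{\mathcal{T}[i,j-1]})=(p_{(i,j)})$; under NO-RED, $\mathrm{ante}(p_{(i,j)})|_{\mathcal{T}[i,j-1]}=(p_{(i,j)})$ ($(\bot)$ = empty clause). Decision policies: LEV-ORD: $\mathrm{lv}(d_i)\le\mathrm{lv}(x)$ for all variables $x$ of $\phi$ unassigned in $\mathcal{T}[i-1,g_{i-1}]$; ASS-ORD: existential literals may always be decided, a universal $d_k$ only if $\mathrm{lv}(d_1)\le\dots\le\mathrm{lv}(d_k)$; ASS-R-ORD: an existential $x$ may be decided only if every universal $u$ with $\mathrm{lv}(u)<\mathrm{lv}(x)$ has already been decided; ANY-ORD: no restriction. A clause $C$ is unit under RED if $\mathrm{red}(C)=(x)$, $x$ existential, or $\mathrm{red}(C)$ empty ($x=\bot$); under NO-RED if $C=(x)$, $x$ existential, or $C$ empty. Natural condition at an initial segment without $\bot$: if some clauses of the current clause set are unit under it, the next element is the literal of one of them with that clause as antecedent, and is $\bot$ if possible; natural trail: holds everywhere. Learnable clauses of a trail ending in $\bot$: $C_{(r,g_r)}=\mathrm{red}(\mathrm{ante}(\bot))$; leftwards over propagated $p$, with $C'$ the clause of the next propagated literal to the right,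 the clause of $p$ is $\mathrm{red}(C'\otimes_p\mathrm{red}(\mathrm{ante}(p)))$ if $\bar p\in C'$, else $C'$; $\mathcal{L}_\mathcal{T}$ is this sequence, each with the derivation given by these steps. A $\mathsf{QCDCL}^{P}_{R}$ proof of $C$ from $\Phi$ is $((\mathcal{T}_1,\dots,\mathcal{T}_m),(C_1,\dots,C_m),(\pi_1,\dots,\pi_m))$: each $\mathcal{T}_i$ a trail following $P,R$ for $\mathcal{Q}\cdot(\phi\cup\{C_1,\dots,C_{i-1}\})$ that has run into a conflict, $C_i\in\mathcal{L}_{\mathcal{T}_i}$ with derivation $\pi_i$, $C_m=C$, $\mathcal{T}_1$ natural, and for $i\ge2$ some $(s,t)$ with $\mathcal{T}_i[s,t]=\mathcal{T}_{i-1}[s,t]$ such that $\mathcal{T}_i$ satisfies the natural condition at all initial segments extending $\mathcal{T}_i[s,t]$. It is a refutation if $C=(\bot)$. -}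

module Defs where

open import Data.Nat using (ℕ; zero; suc; _≤_; _<_; _∸_; _<ᵇ_)
open import Data.Bool using (Bool; true; false; not; _∧_; _∨_; if_then_else_)
open import Data.Bool.Properties using () renaming (_≟_ to _≟B_)
open import Data.Fin using (Fin) renaming (_≟_ to _≟F_)
open import Data.Product using (Σ; _×_; _,_; proj₁; proj₂; ∃)
open import Data.Product.Properties using (≡-dec)
open import Data.Sum using (_⊎_)
open import Data.Maybe using (Maybe; just; nothing)
open import Data.List using (List; []; _∷_; _++_; _∷ʳ_; filterᵇ; map; take; drop; length)
open import Data.Bool.ListAction using (any)
open import Data.List.Membership.Propositional using (_∈_)
open import Data.List.Relation.Unary.All using (All)
open import Data.List.Relation.Unary.Any using (Any)
open import Data.List.Relation.Unary.Unique.Propositional using (Unique)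
open import Data.List.Relation.Unary.Linked using (Linked)
open import Data.Unit using (⊤)
open import Data.Empty using (⊥)
open import Relation.Nullary using (¬_)
open import Relation.Nullary.Decidable using (⌊_⌋)
open import Relation.Binary.PropositionalEquality using (_≡_; _≢_)
open import Function.Bundles using (_⇔_)

data Quant : Set where
  ∃q ∀q : Quant

_==Q_ : Quant → Quant → Bool
∃q ==Q ∃q = true
∀q ==Q ∀q = true
_  ==Q _  = false

-- a literal over variables Fin n: (variable , polarity); true = positive
Lit : ℕ → Set
Lit n = Fin n × Bool

var : ∀ {n} → Lit n → Fin n
var = proj₁

compl : ∀ {n} → Lit n → Lit n
compl (x , b) = (x , not b)

_≟L_ : ∀ {n} (l l' : Lit n) → _
_≟L_ = ≡-dec _≟F_ _≟B_

_==L_ : ∀ {n} → Lit n → Lit n → Bool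
l ==L l' = ⌊ l ≟L l' ⌋

_==V_ : ∀ {n} → Fin n → Fin n → Bool
x ==V y = ⌊ x ≟F y ⌋

elemᵇ : ∀ {n} → Lit n → List (Lit n) → Bool
elemᵇ l C = any (l ==L_) C

-- a clause is a list of literals, read as the set of its members
Clause : ℕ → Set
Clause n = List (Lit n)

_≋_ : ∀ {n} → Clause n → Clause n → Set
C ≋ D = ∀ l → (l ∈ C) ⇔ (l ∈ D)

NonTautological : ∀ {n} → Clause n → Set
NonTautological C = ¬ (Σ _ λ x → ((x , true) ∈ C) × ((x , false) ∈ C))

-- Prefixes and QCNFs.  Blocks are numbered 1..s; lv x is the block of x,
-- q i the quantifier of block i.

record Prefix (n : ℕ) : Set where
  field
    s        : ℕ
    lv       : Fin n → ℕ
    q        : ℕ → Quant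
    lv-range : ∀ x → 1 ≤ lv x × lv x ≤ s
    nonempty : ∀ i → 1 ≤ i → i ≤ s → Σ (Fin n) λ x → lv x ≡ i
    altern   : ∀ i → 1 ≤ i → i < s → q i ≢ q (suc i)

record QCNF (n : ℕ) : Set where
  field
    prefix   : Prefix n
    matrix   : List (Clause n)
    nontaut  : All NonTautological matrix

-- Trails: a trail is a list of entries; decision levels are implicit
-- (each decision starts a new level).

data Entry (n : ℕ) : Set where
  dec      : Lit n → Entry n
  prop     : Lit n → Clause n → Entry n
  conflict : Clause n → Entry n           -- propagated ⊥ with antecedent

Trail : ℕ → Set
Trail n = List (Entry n)

lits : ∀ {n} → Trail n → List (Lit n)
lits []               = []
lits (dec d ∷ T)      = d ∷ lits T
lits (prop p _ ∷ T)   = p ∷ lits T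
lits (conflict _ ∷ T) = lits T

decs : ∀ {n} → Trail n → List (Lit n)
decs []               = []
decs (dec d ∷ T)      = d ∷ decs T
decs (prop _ _ ∷ T)   = decs T
decs (conflict _ ∷ T) = decs T

-- trail with antecedents forgotten (the sequence of decisions / propagated
-- literals / ⊥ which T[s,t] denotes)
data Shape (n : ℕ) : Set where
  sdec  : Lit n → Shape n
  sprop : Lit n → Shape n
  sconf : Shape n

shape : ∀ {n} → Entry n → Shape n
shape (dec d)      = sdec d
shape (prop p _)   = sprop p
shape (conflict _) = sconf

NotConflict : ∀ {n} → Entry n → Set
NotConflict (conflict _) = ⊥
NotConflict _            = ⊤

IsConflict : ∀ {n} → Entry n → Set
IsConflict (conflict _) = ⊤
IsConflict _            = ⊥

IsPropagation : ∀ {n} → Entry n → Set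
IsPropagation (dec _) = ⊥
IsPropagation _       = ⊤

data Policy : Set where
  LEV-ORD ASS-ORD ASS-R-ORD ANY-ORD : Policy

data RedMode : Set where
  RED NO-RED : RedMode

module WithPrefix {n : ℕ} (pf : Prefix n) where
  open Prefix pf

  isE : Fin n → Bool
  isE x = q (lv x) ==Q ∃q

  Existential : Fin n → Set
  Existential x = q (lv x) ≡ ∃q

  Universal : Fin n → Set
  Universal x = q (lv x) ≡ ∀q

  red : Clause n → Clause n
  red C = filterᵇ keep C
    where
    keep : Lit n → Bool
    keep l = isE (var l) ∨ any (λ x → isE (var x) ∧ (lv (var l) <ᵇ lv (var x))) C

  -- C|σ : nothing stands for ⊤
  restrict : Clause n → List (Lit n) → Maybe (Clause n)
  restrict C σ =
    if any (λ l → elemᵇ l σ) C then nothing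
    else just (filterᵇ (λ l → not (elemᵇ (compl l) σ)) C)

  toClause : Maybe (Lit n) → Clause n     -- nothing = ⊥ (empty clause)
  toClause nothing  = []
  toClause (just x) = x ∷ []

  ExistentialM : Maybe (Lit n) → Set
  ExistentialM nothing  = ⊤
  ExistentialM (just x) = Existential (var x)

  UnitAs : RedMode → List (Lit n) → Clause n → Maybe (Lit n) → Set
  UnitAs RED    σ C x = Σ (Clause n) λ D → (restrict C σ ≡ just D) × (red D ≋ toClause x)
  UnitAs NO-RED σ C x = Σ (Clause n) λ D → (restrict C σ ≡ just D) × (D ≋ toClause x)

  Unit : RedMode → List (Lit n) → Clause n → Set
  Unit R σ C = Σ (Maybe (Lit n)) λ x → ExistentialM x × UnitAs R σ C x

  OccursIn : Fin n → List (Clause n) → Set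
  OccursIn x F = Any (λ C → Any (λ l → var l ≡ x) C) F

  PolicyOK : Policy → List (Clause n) → Trail n → Lit n → Set
  PolicyOK LEV-ORD F pre d =
    ∀ x → OccursIn x F → ¬ (x ∈ map var (lits pre)) → lv (var d) ≤ lv x
  PolicyOK ASS-ORD F pre d =
    Universal (var d) → Linked _≤_ (map (λ l → lv (var l)) (decs pre ∷ʳ d))
  PolicyOK ASS-R-ORD F pre d =
    Existential (var d) →
    ∀ u → Universal u → lv u < lv (var d) → u ∈ map var (decs pre)
  PolicyOK ANY-ORD F pre d = ⊤

  EntryOK : Policy → RedMode → List (Clause n) → Trail n → Entry n → Set
  EntryOK P R F pre (dec d)      = PolicyOK P F pre d
  EntryOK P R F pre (prop p a)   = (a ∈ F) × Existential (var p) × UnitAs R (lits pre) a (just p)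
  EntryOK P R F pre (conflict a) = (a ∈ F) × UnitAs R (lits pre) a nothing

  ConflictTrail : Policy → RedMode → List (Clause n) → Trail n → Set
  ConflictTrail P R F T =
    (Σ (Trail n) λ init → Σ (Clause n) λ a → (T ≡ init ∷ʳ conflict a) × All NotConflict init)
    × Unique (map var (lits T))
    × (∀ k e rest → drop k T ≡ e ∷ rest → EntryOK P R F (take k T) e)

  NaturalAt : RedMode → List (Clause n) → Trail n → ℕ → Set
  NaturalAt R F T k = ∀ e rest → drop k T ≡ e ∷ rest →
      ((Σ (Clause n) λ C → (C ∈ F) × Unit R (lits (take k T)) C) → IsPropagation e)
    × ((Σ (Clause n) λ C → (C ∈ F) × UnitAs R (lits (take k T)) C nothing) → IsConflict e)

  resolve : Lit n → Clause n → Clause n → Clause n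
  resolve p C D = filterᵇ (λ l → not (var l ==V var p)) C ++ filterᵇ (λ l → not (var l ==V var p)) D

  -- input: clause of the next propagated literal to the right, and the
  -- remaining entries from right to left
  learnFrom : Clause n → Trail n → List (Clause n)
  learnFrom C' []                 = []
  learnFrom C' (dec _ ∷ es)       = learnFrom C' es
  learnFrom C' (conflict _ ∷ es)  = learnFrom C' es
  learnFrom C' (prop p a ∷ es)    = C'' ∷ learnFrom C'' es
    where
    C'' : Clause n
    C'' = if elemᵇ (compl p) C' then red (resolve p C' (red a)) else C'

  Learnable : Trail n → Clause n → Set
  Learnable T C = Σ (Trail n) λ init → Σ (Clause n) λ a →
    (T ≡ init ∷ʳ conflict a) × (C ∈ (red a ∷ learnFrom (red a) (Data.List.reverse init)))

  -- validity of a sequence of (trail, learned clause) steps, given the current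
  -- clause set and the previous trail (nothing for the first step)
  ValidSteps : Policy → RedMode → List (Clause n) → Maybe (Trail n) →
               List (Trail n × Clause n) → Set
  ValidSteps P R F prev [] = ⊤
  ValidSteps P R F prev ((T , C) ∷ rest) =
    ConflictTrail P R F T × Learnable T C × Link prev
    × ValidSteps P R (F ∷ʳ C) (just T) rest
    where
    Link : Maybe (Trail n) → Set
    Link nothing   = ∀ k → NaturalAt R F T k
    Link (just T') = Σ ℕ λ k → (k ≤ length T) × (k ≤ length T')
                     × (map shape (take k T) ≡ map shape (take k T'))
                     × (∀ k' → k ≤ k' → NaturalAt R F T k')

  Sat : List (Clause n) → (Fin n → Bool) → Set
  Sat F α = All (λ C → Any (λ l → α (var l) ≡ proj₂ l) C) F

  Agree : ℕ → (Fin n → Bool) → (Fin n → Bool) → Set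
  Agree i α β = ∀ x → lv x ≢ i → α x ≡ β x

  QStep : Quant → ((Fin n → Bool) → Set) → ((Fin n → Bool) → Set) → Set
  QStep ∃q A B = Σ (Fin n → Bool) λ β → A β × B β
  QStep ∀q A B = ∀ β → A β → B β

  -- V m α : value after quantifying blocks s-m+1 .. s (over α)
  V : List (Clause n) → ℕ → (Fin n → Bool) → Set
  V F zero    α = Sat F α
  V F (suc m) α = QStep (q (s ∸ m)) (Agree (s ∸ m) α) (V F m)

open WithPrefix public using ()

IsTrue : ∀ {n} → QCNF n → Set
IsTrue Φ = WithPrefix.V (QCNF.prefix Φ) (QCNF.matrix Φ) (Prefix.s (QCNF.prefix Φ)) (λ _ → false)

IsFalse : ∀ {n} → QCNF n → Set
IsFalse Φ = ¬ IsTrue Φ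

ProofOf : ∀ {n} → Policy → RedMode → QCNF n → Clause n → Set
ProofOf {n} P R Φ C = Σ (List (Trail n × Clause n)) λ steps → Σ (Trail n) λ T →
  WithPrefix.ValidSteps (QCNF.prefix Φ) P R (QCNF.matrix Φ) nothing (steps ∷ʳ (T , C))

Refutation : ∀ {n} → Policy → RedMode → QCNF n → Set
Refutation P R Φ = ProofOf P R Φ []

module Submission where

-- Run QCDCL with one regular strategy: propagate unit clauses to a fixpoint (preferring conflicts)
-- and decide only at unit-free trails, on a variable of least unassigned level. Such trails are
-- natural and level-ordered, hence admissible under every policy, and each one may start afresh
-- from the empty trail. If this strategy never met a conflict, the tree of its trails, branching
-- on both values of each universal decision, would be a winning strategy for the existential
-- player, so a false QCNF always yields a conflict. The clause learned from it (resolving the last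
-- decision level under RED, the whole trail under NO-RED) is empty or asserting: it would have been
-- unit (or empty) just before the last decision, where the trail was unit-free, so it is new up to
-- set equality. There are finitely many clauses, so the empty clause is eventually learned.

open import Defs
open import Data.Nat using (ℕ; zero; suc; _≤_; _<_; _∸_; _+_; z≤n; s≤s; _<ᵇ_)
open import Data.Nat.Properties
open import Data.Bool using (Bool; true; false; not; _∧_; _∨_; if_then_else_; T; T?)
open import Data.Bool.Properties using (T-∨; T-∧; T-≡; T-not-≡; not-¬; ¬-not; not-involutive)
open import Data.Fin using (Fin) renaming (_≟_ to _≟F_)
open import Data.Product using (Σ; _×_; _,_; proj₁; proj₂)
open import Data.Sum using (_⊎_; inj₁; inj₂; [_,_]′)
open import Data.Maybe using (Maybe; just; nothing)
open import Data.List using (List; []; _∷_; _++_; _∷ʳ_; filterᵇ; filter; map; take; drop; length; reverse; allFin)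
open import Data.Bool.ListAction using (any)
open import Data.List.Membership.Propositional using (_∈_; _∉_; lose; find)
open import Data.List.Membership.Propositional.Properties
  using (∈-filter⁺; ∈-filter⁻; ∈-++⁺ˡ; ∈-++⁺ʳ; ∈-++⁻; ∈-allFin; ∈-map⁺; ∈-map⁻)
open import Data.List.Relation.Unary.All using (All; []; _∷_)
import Data.List.Relation.Unary.All as All
open import Data.List.Relation.Unary.All.Properties using (∷ʳ⁺; all-filter)
open import Data.List.Extrema.Nat using (argmin; argmin-all; f[argmin]≤f[⊤]; f[argmin]≤f[xs])
import Data.List.Relation.Unary.AllPairs as AllPairs
import Data.List.Relation.Unary.AllPairs.Properties as AllPairsₚ
open import Data.List.Relation.Unary.Unique.Propositional using (Unique)
open import Data.List.Relation.Unary.Linked using (Linked; [-])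
open import Data.List.Properties using (map-++; ++-identityʳ; reverse-++)
open import Data.List.Relation.Unary.Any using (Any; here; there; any?)
import Data.List.Relation.Unary.Any as Any
open import Data.List.Relation.Unary.Any.Properties using (any⁺; any⁻; singleton⁻; ¬Any[])
open import Data.Unit using (⊤; tt)
open import Data.Empty using (⊥; ⊥-elim)
open import Relation.Nullary using (¬_; Dec; yes; no; ¬?; contradiction)
open import Relation.Nullary.Decidable using (_×-dec_; _→-dec_)
open import Relation.Unary using (Decidable)
open import Relation.Binary.PropositionalEquality using (_≡_; _≢_; refl; sym; trans; cong; subst)
open import Function.Bundles using (mk⇔; Equivalence)

∀∉⇒≡[] : ∀ {A : Set} (xs : List A) → (∀ x → x ∉ xs) → xs ≡ []
∀∉⇒≡[] []       _ = refl
∀∉⇒≡[] (x ∷ xs) h = ⊥-elim (h x (here refl))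

module _ {A : Set} {P Q : A → Set} (P? : Decidable P) (Q? : Decidable Q) (P⇒Q : ∀ x → P x → Q x) where

  length-filter-mono : ∀ xs → length (filter P? xs) ≤ length (filter Q? xs)
  length-filter-mono [] = z≤n
  length-filter-mono (x ∷ xs) with P? x | Q? x
  ... | yes _  | yes _  = s≤s (length-filter-mono xs)
  ... | yes px | no ¬qx = ⊥-elim (¬qx (P⇒Q x px))
  ... | no _   | yes _  = m≤n⇒m≤1+n (length-filter-mono xs)
  ... | no _   | no _   = length-filter-mono xs

  length-filter-strictMono : ∀ xs y → y ∈ xs → Q y → ¬ P y →
                             length (filter P? xs) < length (filter Q? xs)
  length-filter-strictMono (x ∷ xs) y (here refl) qy ¬py with P? x | Q? x
  ... | yes py | _      = ⊥-elim (¬py py)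
  ... | no _   | yes _  = s≤s (length-filter-mono xs)
  ... | no _   | no ¬qy = ⊥-elim (¬qy qy)
  length-filter-strictMono (x ∷ xs) y (there y∈xs) qy ¬py with P? x | Q? x
  ... | yes _  | yes _  = s≤s (length-filter-strictMono xs y y∈xs qy ¬py)
  ... | yes px | no ¬qx = ⊥-elim (¬qx (P⇒Q x px))
  ... | no _   | yes _  = m≤n⇒m≤1+n (length-filter-strictMono xs y y∈xs qy ¬py)
  ... | no _   | no _   = length-filter-strictMono xs y y∈xs qy ¬py

sublists : ∀ {A : Set} → List A → List (List A)
sublists []       = [] ∷ []
sublists (x ∷ xs) = map (x ∷_) (sublists xs) ++ sublists xs

filter∈sublists : ∀ {A : Set} {P : A → Set} (P? : Decidable P) xs → filter P? xs ∈ sublists xs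
filter∈sublists P? [] = here refl
filter∈sublists P? (x ∷ xs) with P? x
... | yes _ = ∈-++⁺ˡ (∈-map⁺ (x ∷_) (filter∈sublists P? xs))
... | no _  = ∈-++⁺ʳ (map (x ∷_) (sublists xs)) (filter∈sublists P? xs)

Linked-∷ʳ : ∀ (xs : List ℕ) y → Linked _≤_ xs → All (_≤ y) xs → Linked _≤_ (xs ∷ʳ y)
Linked-∷ʳ []             y _                _            = [-]
Linked-∷ʳ (x ∷ [])       y _                (x≤y ∷ _)    = x≤y Linked.∷ [-]
Linked-∷ʳ (x ∷ x' ∷ xs)  y (x≤x' Linked.∷ l) (_ ∷ xs≤y)   = x≤x' Linked.∷ Linked-∷ʳ (x' ∷ xs) y l xs≤y

EveryPrefix : ∀ {A : Set} → (List A → A → Set) → List A → Set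
EveryPrefix P []       = ⊤
EveryPrefix P (x ∷ xs) = P [] x × EveryPrefix (λ pre → P (x ∷ pre)) xs

EveryPrefix-∷ʳ : ∀ {A : Set} P (xs : List A) x → EveryPrefix P xs → P xs x → EveryPrefix P (xs ∷ʳ x)
EveryPrefix-∷ʳ P []       x _           px = px , tt
EveryPrefix-∷ʳ P (y ∷ xs) x (py , pxs) px = py , EveryPrefix-∷ʳ (λ pre → P (y ∷ pre)) xs x pxs px

EveryPrefix-map : ∀ {A : Set} {P Q : List A → A → Set} xs →
                  (∀ pre x → P pre x → Q pre x) → EveryPrefix P xs → EveryPrefix Q xs
EveryPrefix-map []                 f _          = tt
EveryPrefix-map {P = P} {Q} (y ∷ xs) f (py , pxs) =
  f [] y py , EveryPrefix-map {P = λ pre → P (y ∷ pre)} {λ pre → Q (y ∷ pre)} xs (λ pre → f (y ∷ pre)) pxs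

EveryPrefix-drop : ∀ {A : Set} P (xs : List A) → EveryPrefix P xs →
                   ∀ k x rest → drop k xs ≡ x ∷ rest → P (take k xs) x
EveryPrefix-drop P (y ∷ xs) (py , _)   zero    .y .xs refl = py
EveryPrefix-drop P (y ∷ xs) (_ , pxs)  (suc k) x  rest eq  =
  EveryPrefix-drop (λ pre → P (y ∷ pre)) xs pxs k x rest eq

reverse-∷ʳ : ∀ {A : Set} (xs : List A) x → reverse (xs ∷ʳ x) ≡ x ∷ reverse xs
reverse-∷ʳ xs x = reverse-++ xs (x ∷ [])

module _ {a m s : ℕ} where

  +≡⇒≡∸ : a + m ≡ s → a ≡ s ∸ m
  +≡⇒≡∸ eq = trans (sym (m+n∸n≡m a m)) (cong (_∸ m) eq)

  ≡∸⇒+suc≰ : a ≡ s ∸ m → ¬ (a + suc m ≤ s)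
  ≡∸⇒+suc≰ eq le = <-irrefl refl (≤-trans (s≤s (≤-reflexive (sym a+m≡s))) (subst (_≤ s) (+-suc a m) le))
    where
    a+m≡s : a + m ≡ s
    a+m≡s = trans (cong (_+ m) eq) (m∸n+n≡m (<⇒≤ (≤-trans (m≤n+m (suc m) a) le)))

  ≤∸⇒+≤ : 1 ≤ a → a ≤ s ∸ m → a + m ≤ s
  ≤∸⇒+≤ 1≤a le with m ≤? s
  ... | yes m≤s = m≤o∸n⇒m+n≤o a m≤s le
  ... | no m≰s  = ⊥-elim (<⇒≱ 1≤a (subst (a ≤_) (m≤n⇒m∸n≡0 (<⇒≤ (≰⇒> m≰s))) le))

  <+suc⇒<+ : s < a + suc m → a ≢ s ∸ m → s < a + m
  <+suc⇒<+ lt ne = ≤∧≢⇒< (≤-pred (subst (s <_) (+-suc a m) lt)) (λ eq → ne (+≡⇒≡∸ (sym eq)))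

  +≤⇒+suc≤ : a + m ≤ s → a ≢ s ∸ m → a + suc m ≤ s
  +≤⇒+suc≤ le ne = subst (_≤ s) (sym (+-suc a m)) (≤∧≢⇒< le (λ eq → ne (+≡⇒≡∸ eq)))

module _ {n : ℕ} where

  open import Data.List.Membership.DecPropositional (_≟L_ {n}) using (_∈?_) public

  compl-involutive : (l : Lit n) → compl (compl l) ≡ l
  compl-involutive (x , b) = cong (x ,_) (not-involutive b)

  compl-≢ : (l : Lit n) → compl l ≢ l
  compl-≢ (_ , true)  ()
  compl-≢ (_ , false) ()

  compl≡⇒≡compl : ∀ {l k : Lit n} → compl l ≡ k → l ≡ compl k
  compl≡⇒≡compl {l} refl = sym (compl-involutive l)

  same-var⇒≡⊎≡compl : (l l' : Lit n) → var l ≡ var l' → (l ≡ l') ⊎ (l ≡ compl l')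
  same-var⇒≡⊎≡compl (x , true)  (.x , true)  refl = inj₁ refl
  same-var⇒≡⊎≡compl (x , true)  (.x , false) refl = inj₂ refl
  same-var⇒≡⊎≡compl (x , false) (.x , true)  refl = inj₂ refl
  same-var⇒≡⊎≡compl (x , false) (.x , false) refl = inj₁ refl

  elemᵇ⇒∈ : ∀ (l : Lit n) σ → elemᵇ l σ ≡ true → l ∈ σ
  elemᵇ⇒∈ l (x ∷ σ) h with l ≟L x
  ... | yes refl = here refl
  ... | no _     = there (elemᵇ⇒∈ l σ h)

  ∈⇒elemᵇ : ∀ (l : Lit n) σ → l ∈ σ → elemᵇ l σ ≡ true
  ∈⇒elemᵇ l (x ∷ σ) (here refl) with l ≟L l
  ... | yes _  = refl
  ... | no l≢l = ⊥-elim (l≢l refl)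
  ∈⇒elemᵇ l (x ∷ σ) (there l∈σ) with l ≟L x
  ... | yes _ = refl
  ... | no _  = ∈⇒elemᵇ l σ l∈σ

  []≋[] : _≋_ {n} [] []
  []≋[] _ = mk⇔ (λ m → m) (λ m → m)

  ≋-sym : {C D : Clause n} → C ≋ D → D ≋ C
  ≋-sym C≋D l = mk⇔ (Equivalence.from (C≋D l)) (Equivalence.to (C≋D l))

  ≋-trans : {B C D : Clause n} → B ≋ C → C ≋ D → B ≋ D
  ≋-trans B≋C C≋D l = mk⇔ (λ m → Equivalence.to (C≋D l) (Equivalence.to (B≋C l) m))
                          (λ m → Equivalence.from (B≋C l) (Equivalence.from (C≋D l) m))

  literalsOf : List (Fin n) → List (Lit n)
  literalsOf []       = []
  literalsOf (x ∷ xs) = (x , true) ∷ (x , false) ∷ literalsOf xs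

  ∈-literalsOf : ∀ xs (l : Lit n) → var l ∈ xs → l ∈ literalsOf xs
  ∈-literalsOf (x ∷ xs) (.x , true)  (here refl) = here refl
  ∈-literalsOf (x ∷ xs) (.x , false) (here refl) = there (here refl)
  ∈-literalsOf (x ∷ xs) l (there l∈xs) = there (there (∈-literalsOf xs l l∈xs))

  allLits : List (Lit n)
  allLits = literalsOf (allFin n)

  ∈-allLits : ∀ l → l ∈ allLits
  ∈-allLits l = ∈-literalsOf (allFin n) l (∈-allFin (var l))

  normalForm : Clause n → Clause n
  normalForm C = filter (_∈? C) allLits

  normalForm≋ : ∀ C → normalForm C ≋ C
  normalForm≋ C l = mk⇔ (λ m → proj₂ (∈-filter⁻ (_∈? C) {xs = allLits} m))
                       (∈-filter⁺ (_∈? C) (∈-allLits l))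

  _≋?_ : (C D : Clause n) → Dec (C ≋ D)
  C ≋? D with All.all? (λ l → ((l ∈? C) →-dec (l ∈? D)) ×-dec ((l ∈? D) →-dec (l ∈? C))) allLits
  ... | yes both = yes (λ l → let to , from = All.lookup both (∈-allLits l) in mk⇔ to from)
  ... | no ¬both = no (λ C≋D → ¬both (All.tabulate (λ {l} _ → Equivalence.to (C≋D l) , Equivalence.from (C≋D l))))

  New : List (Clause n) → Clause n → Set
  New F C = ∀ D → D ∈ F → ¬ (C ≋ D)

  #unrepresented : List (Clause n) → ℕ
  #unrepresented F = length (filter (λ S → ¬? (any? (S ≋?_) F)) (sublists allLits))

  #unrepresented-∷ʳ-New : ∀ F C → New F C → #unrepresented (F ∷ʳ C) < #unrepresented F
  #unrepresented-∷ʳ-New F C new =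
    length-filter-strictMono _ _ still-unrepresented (sublists allLits) (normalForm C)
      (filter∈sublists (_∈? C) allLits) unrepresented-before represented-after
    where
    still-unrepresented : ∀ S → ¬ Any (S ≋_) (F ∷ʳ C) → ¬ Any (S ≋_) F
    still-unrepresented S ¬rep rep = let D , D∈F , S≋D = find rep in ¬rep (lose (∈-++⁺ˡ D∈F) S≋D)
    unrepresented-before : ¬ Any (normalForm C ≋_) F
    unrepresented-before rep = let D , D∈F , S≋D = find rep in new D D∈F (≋-trans (≋-sym (normalForm≋ C)) S≋D)
    represented-after : ¬ ¬ Any (normalForm C ≋_) (F ∷ʳ C)
    represented-after ¬rep = ¬rep (lose (∈-++⁺ʳ F (here refl)) (normalForm≋ C))

module Completeness {n : ℕ} (pf : Prefix n) where
  open Prefix pf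
  open WithPrefix pf

  isE⇒Existential : ∀ x → T (isE x) → Existential x
  isE⇒Existential x h with q (lv x)
  ... | ∃q = refl

  Existential⇒isE : ∀ x → Existential x → T (isE x)
  Existential⇒isE x ∃x = subst (λ a → T (a ==Q ∃q)) (sym ∃x) tt

  Existential⊎Universal : ∀ x → Existential x ⊎ Universal x
  Existential⊎Universal x with q (lv x)
  ... | ∃q = inj₁ refl
  ... | ∀q = inj₂ refl

  ¬Existential×Universal : ∀ {x} → Existential x → Universal x → ⊥
  ¬Existential×Universal ∃x ∀x with trans (sym ∃x) ∀x
  ... | ()

  Existential-lv≢Universal-lv : ∀ {x y} → Existential x → Universal y → lv x ≢ lv y
  Existential-lv≢Universal-lv ∃x ∀y eq = ¬Existential×Universal (trans (cong q (sym eq)) ∃x) ∀y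

  private
    keep : Clause n → Lit n → Bool
    keep C l = isE (var l) ∨ any (λ x → isE (var x) ∧ (lv (var l) <ᵇ lv (var x))) C

    ∈red⇒keep : ∀ {C l} → l ∈ red C → (l ∈ C) × T (keep C l)
    ∈red⇒keep {C} = ∈-filter⁻ (λ l → T? (keep C l))

  ∈red⇒∈ : ∀ {C l} → l ∈ red C → l ∈ C
  ∈red⇒∈ {C} l∈ = proj₁ (∈red⇒keep {C} l∈)

  ∈⇒∈red : ∀ {C l} → l ∈ C → Existential (var l) → l ∈ red C
  ∈⇒∈red {C} {l} l∈C ∃l =
    ∈-filter⁺ (λ l → T? (keep C l)) l∈C (Equivalence.from T-∨ (inj₁ (Existential⇒isE (var l) ∃l)))

  ∈red-Universal⇒∃-above : ∀ {C l} → l ∈ red C → Universal (var l) →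
                            Σ (Lit n) λ x → (x ∈ C) × Existential (var x) × (lv (var l) < lv (var x))
  ∈red-Universal⇒∃-above {C} {l} l∈ ∀l with Equivalence.to T-∨ (proj₂ (∈red⇒keep {C} l∈))
  ... | inj₁ isE-l = ⊥-elim (¬Existential×Universal (isE⇒Existential (var l) isE-l) ∀l)
  ... | inj₂ above with find (any⁻ _ C above)
  ... | x , x∈C , t with Equivalence.to T-∧ t
  ... | isE-x , lt = x , x∈C , isE⇒Existential (var x) isE-x , <ᵇ⇒< _ _ lt

  red≡[] : ∀ C → (∀ x → x ∈ C → ¬ Existential (var x)) → red C ≡ []
  red≡[] C no∃ = ∀∉⇒≡[] (red C) absent
    where
    absent : ∀ l → l ∉ red C
    absent l l∈ with Existential⊎Universal (var l)
    ... | inj₁ ∃l = no∃ l (∈red⇒∈ l∈) ∃l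
    ... | inj₂ ∀l = let x , x∈C , ∃x , _ = ∈red-Universal⇒∃-above l∈ ∀l in no∃ x x∈C ∃x

  red≋[_] : ∀ {C} e → e ∈ C → Existential (var e) →
            (∀ l → l ∈ C → (l ≡ e) ⊎ (Universal (var l) × (lv (var e) < lv (var l)))) →
            red C ≋ (e ∷ [])
  red≋[_] {C} e e∈C ∃e others l = mk⇔ to (λ { (here refl) → ∈⇒∈red e∈C ∃e })
    where
    to : l ∈ red C → l ∈ e ∷ []
    to l∈ with others l (∈red⇒∈ l∈)
    ... | inj₁ l≡e = here l≡e
    ... | inj₂ (∀l , e<l) with ∈red-Universal⇒∃-above l∈ ∀l
    ... | x , x∈C , ∃x , l<x with others x x∈C
    ... | inj₁ refl = ⊥-elim (<-asym e<l l<x)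
    ... | inj₂ (∀x , _) = ⊥-elim (¬Existential×Universal ∃x ∀x)

  restrict≡nothing⇒satisfied : ∀ C σ → restrict C σ ≡ nothing → Σ (Lit n) λ l → (l ∈ C) × (l ∈ σ)
  restrict≡nothing⇒satisfied C σ h with any (λ l → elemᵇ l σ) C in eq
  ... | true = let l , l∈C , t = find (any⁻ (λ l → elemᵇ l σ) C (Equivalence.from T-≡ eq))
               in l , l∈C , elemᵇ⇒∈ l σ (Equivalence.to T-≡ t)

  record Restriction (C : Clause n) (σ : List (Lit n)) (D : Clause n) : Set where
    field
      unsatisfied : ∀ l → l ∈ C → l ∉ σ
      ∈⇒∈C×¬falsified : ∀ l → l ∈ D → (l ∈ C) × (compl l ∉ σ)
      ¬falsified⇒∈ : ∀ l → l ∈ C → compl l ∉ σ → l ∈ D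

  restrict≡just⇒Restriction : ∀ C σ {D} → restrict C σ ≡ just D → Restriction C σ D
  restrict≡just⇒Restriction C σ h with any (λ l → elemᵇ l σ) C in eq
  restrict≡just⇒Restriction C σ refl | false = record
    { unsatisfied = λ l l∈C l∈σ → not-¬ (satisfied l l∈C l∈σ) eq
    ; ∈⇒∈C×¬falsified = λ l l∈D → let l∈C , t = ∈-filter⁻ kept? l∈D
                                   in l∈C , λ m → not-¬ (∈⇒elemᵇ (compl l) σ m) (Equivalence.to T-not-≡ t)
    ; ¬falsified⇒∈ = λ l l∈C ¬f →
        ∈-filter⁺ kept? l∈C (Equivalence.from T-not-≡ (¬-not (λ e → ¬f (elemᵇ⇒∈ (compl l) σ e))))
    }
    where
    kept? = λ l → T? (not (elemᵇ (compl l) σ))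
    satisfied : ∀ l → l ∈ C → l ∈ σ → any (λ l → elemᵇ l σ) C ≡ true
    satisfied l l∈C l∈σ =
      Equivalence.to T-≡ (any⁺ (λ l → elemᵇ l σ) (lose l∈C (Equivalence.from T-≡ (∈⇒elemᵇ l σ l∈σ))))

  Assigned : List (Lit n) → Fin n → Set
  Assigned σ y = Any (λ l → var l ≡ y) σ

  Assigned? : ∀ σ y → Dec (Assigned σ y)
  Assigned? σ y = any? (λ l → var l ≟F y) σ

  ∈⇒Assigned : ∀ {σ l} → l ∈ σ → Assigned σ (var l)
  ∈⇒Assigned l∈σ = lose l∈σ refl

  Assigned⇒∈map : ∀ {σ x} → Assigned σ x → x ∈ map var σ
  Assigned⇒∈map a with find a
  ... | _ , l∈σ , refl = ∈-map⁺ var l∈σ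

  ¬Assigned : ∀ {σ} (p : Lit n) → p ∉ σ → compl p ∉ σ → ¬ Assigned σ (var p)
  ¬Assigned p p∉σ ¬p∉σ a with find a
  ... | l , l∈σ , eq with same-var⇒≡⊎≡compl l p eq
  ... | inj₁ refl = p∉σ l∈σ
  ... | inj₂ refl = ¬p∉σ l∈σ

  Assigned-mono : ∀ {σ σ'} → (∀ l → l ∈ σ → l ∈ σ') → ∀ y → Assigned σ y → Assigned σ' y
  Assigned-mono σ⊆σ' y a = let l , l∈σ , eq = find a in lose (σ⊆σ' l l∈σ) eq

  Reduce : RedMode → Clause n → Clause n
  Reduce RED    = red
  Reduce NO-RED = λ D → D

  Reduce-⊆ : ∀ R {D l} → l ∈ Reduce R D → l ∈ D
  Reduce-⊆ RED {D} = ∈red⇒∈ {D}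
  Reduce-⊆ NO-RED  = λ m → m

  Reduce-[] : ∀ R → Reduce R [] ≡ []
  Reduce-[] RED    = refl
  Reduce-[] NO-RED = refl

  UnitAs′ : RedMode → List (Lit n) → Clause n → Maybe (Lit n) → Set
  UnitAs′ R σ C x = Σ (Clause n) λ D → (restrict C σ ≡ just D) × (Reduce R D ≋ toClause x)

  UnitAs⇒UnitAs′ : ∀ R {σ C x} → UnitAs R σ C x → UnitAs′ R σ C x
  UnitAs⇒UnitAs′ RED    u = u
  UnitAs⇒UnitAs′ NO-RED u = u

  UnitAs′⇒UnitAs : ∀ R {σ C x} → UnitAs′ R σ C x → UnitAs R σ C x
  UnitAs′⇒UnitAs RED    u = u
  UnitAs′⇒UnitAs NO-RED u = u

  unit-literal-unassigned : ∀ R {σ C p} → UnitAs R σ C (just p) → (p ∈ C) × ¬ Assigned σ (var p)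
  unit-literal-unassigned R {σ} {C} {p} u with UnitAs⇒UnitAs′ R {σ} {C} u
  ... | D , eq , D≋p = p∈C , ¬Assigned p (unsatisfied p p∈C) ¬falsified
    where
    open Restriction (restrict≡just⇒Restriction C σ eq)
    p∈C×¬falsified = ∈⇒∈C×¬falsified p (Reduce-⊆ R (Equivalence.from (D≋p p) (here refl)))
    p∈C = proj₁ p∈C×¬falsified
    ¬falsified = proj₂ p∈C×¬falsified

  entryLits : Entry n → List (Lit n)
  entryLits (dec d)      = d ∷ []
  entryLits (prop p _)   = p ∷ []
  entryLits (conflict _) = []

  entryDecs : Entry n → List (Lit n)
  entryDecs (dec d)      = d ∷ []
  entryDecs (prop _ _)   = []
  entryDecs (conflict _) = []

  lits-∷ʳ : ∀ (T : Trail n) e → lits (T ∷ʳ e) ≡ lits T ++ entryLits e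
  lits-∷ʳ []                 (dec _)      = refl
  lits-∷ʳ []                 (prop _ _)   = refl
  lits-∷ʳ []                 (conflict _) = refl
  lits-∷ʳ (dec d ∷ T)        e = cong (d ∷_) (lits-∷ʳ T e)
  lits-∷ʳ (prop p _ ∷ T)     e = cong (p ∷_) (lits-∷ʳ T e)
  lits-∷ʳ (conflict _ ∷ T)   e = lits-∷ʳ T e

  decs-∷ʳ : ∀ (T : Trail n) e → decs (T ∷ʳ e) ≡ decs T ++ entryDecs e
  decs-∷ʳ []                 (dec _)      = refl
  decs-∷ʳ []                 (prop _ _)   = refl
  decs-∷ʳ []                 (conflict _) = refl
  decs-∷ʳ (dec d ∷ T)        e = cong (d ∷_) (decs-∷ʳ T e)
  decs-∷ʳ (prop _ _ ∷ T)     e = decs-∷ʳ T e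
  decs-∷ʳ (conflict _ ∷ T)   e = decs-∷ʳ T e

  module _ {T : Trail n} {e : Entry n} {l : Lit n} where

    ∈lits-∷ʳ⁻ : l ∈ lits (T ∷ʳ e) → (l ∈ lits T) ⊎ (l ∈ entryLits e)
    ∈lits-∷ʳ⁻ m = ∈-++⁻ (lits T) (subst (l ∈_) (lits-∷ʳ T e) m)

    ∈lits-∷ʳ⁺ˡ : l ∈ lits T → l ∈ lits (T ∷ʳ e)
    ∈lits-∷ʳ⁺ˡ m = subst (l ∈_) (sym (lits-∷ʳ T e)) (∈-++⁺ˡ m)

    ∈lits-∷ʳ⁺ʳ : l ∈ entryLits e → l ∈ lits (T ∷ʳ e)
    ∈lits-∷ʳ⁺ʳ m = subst (l ∈_) (sym (lits-∷ʳ T e)) (∈-++⁺ʳ (lits T) m)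

    ∈decs-∷ʳ⁻ : l ∈ decs (T ∷ʳ e) → (l ∈ decs T) ⊎ (l ∈ entryDecs e)
    ∈decs-∷ʳ⁻ m = ∈-++⁻ (decs T) (subst (l ∈_) (decs-∷ʳ T e) m)

    ∈decs-∷ʳ⁺ˡ : l ∈ decs T → l ∈ decs (T ∷ʳ e)
    ∈decs-∷ʳ⁺ˡ m = subst (l ∈_) (sym (decs-∷ʳ T e)) (∈-++⁺ˡ m)

    ∈decs-∷ʳ⁺ʳ : l ∈ entryDecs e → l ∈ decs (T ∷ʳ e)
    ∈decs-∷ʳ⁺ʳ m = subst (l ∈_) (sym (decs-∷ʳ T e)) (∈-++⁺ʳ (decs T) m)

  Assigned-∷ʳ : ∀ {T e} y → Assigned (lits T) y → Assigned (lits (T ∷ʳ e)) y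
  Assigned-∷ʳ {T} {e} = Assigned-mono (λ l → ∈lits-∷ʳ⁺ˡ {T} {e})

  decs⊆lits : ∀ (T : Trail n) {l} → l ∈ decs T → l ∈ lits T
  decs⊆lits (dec d ∷ T)      (here p) = here p
  decs⊆lits (dec d ∷ T)      (there m) = there (decs⊆lits T m)
  decs⊆lits (prop p _ ∷ T)   m = there (decs⊆lits T m)
  decs⊆lits (conflict _ ∷ T) m = decs⊆lits T m

  entryLits-≤1 : ∀ e {k k' : Lit n} → k ∈ entryLits e → k' ∈ entryLits e → k ≡ k'
  entryLits-≤1 (dec d)    (here refl) (here refl) = refl
  entryLits-≤1 (prop p _) (here refl) (here refl) = refl

  lvˡ : Lit n → ℕ
  lvˡ l = lv (var l)

  module Canonical (R : RedMode) (F : List (Clause n)) where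

    NoUnit : Trail n → Set
    NoUnit T = ¬ (Σ (Clause n) λ C → (C ∈ F) × Unit R (lits T) C)

    NoEmpty : Trail n → Set
    NoEmpty T = ¬ (Σ (Clause n) λ C → (C ∈ F) × UnitAs R (lits T) C nothing)

    data Step (T : Trail n) : Entry n → Set where
      decision    : ∀ d → ¬ Assigned (lits T) (var d) →
                    (∀ y → ¬ Assigned (lits T) y → lvˡ d ≤ lv y) → NoUnit T → Step T (dec d)
      propagation : ∀ p a → a ∈ F → Existential (var p) → UnitAs R (lits T) a (just p) →
                    NoEmpty T → Step T (prop p a)

    infixl 5 _▷_
    data CanonicalTrail : Trail n → Set where
      []  : CanonicalTrail []
      _▷_ : ∀ {T e} → CanonicalTrail T → Step T e → CanonicalTrail (T ∷ʳ e)

    step-unassigned : ∀ {T e} → Step T e → ∀ l → l ∈ entryLits e → ¬ Assigned (lits T) (var l)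
    step-unassigned (decision d ¬a _ _) _ (here refl) = ¬a
    step-unassigned {T} (propagation p a _ _ u _) _ (here refl) = proj₂ (unit-literal-unassigned R {lits T} {a} u)

    consistent : ∀ {T} → CanonicalTrail T → ∀ l → l ∈ lits T → compl l ∉ lits T
    consistent (_▷_ {T} {e} v st) l l∈ ¬l∈ with ∈lits-∷ʳ⁻ {T} {e} l∈ | ∈lits-∷ʳ⁻ {T} {e} ¬l∈
    ... | inj₁ a | inj₁ b = consistent v l a b
    ... | inj₁ a | inj₂ b = step-unassigned st (compl l) b (∈⇒Assigned a)
    ... | inj₂ a | inj₁ b = step-unassigned st l a (∈⇒Assigned b)
    ... | inj₂ a | inj₂ b = compl-≢ l (entryLits-≤1 e b a)

    Universal⇒decision : ∀ {T} → CanonicalTrail T → ∀ l → l ∈ lits T → Universal (var l) → l ∈ decs T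
    Universal⇒decision (_▷_ {T} {dec d} v _) l l∈ ∀l with ∈lits-∷ʳ⁻ {T} {dec d} l∈
    ... | inj₁ a = ∈decs-∷ʳ⁺ˡ {T} {dec d} (Universal⇒decision v l a ∀l)
    ... | inj₂ a = ∈decs-∷ʳ⁺ʳ {T} {dec d} a
    Universal⇒decision (_▷_ {T} {prop p a} v (propagation _ _ _ ∃p _ _)) l l∈ ∀l with ∈lits-∷ʳ⁻ {T} {prop p a} l∈
    ... | inj₁ m = ∈decs-∷ʳ⁺ˡ {T} {prop p a} (Universal⇒decision v l m ∀l)
    ... | inj₂ (here refl) = ⊥-elim (¬Existential×Universal ∃p ∀l)

    decision-lv≤unassigned : ∀ {T} → CanonicalTrail T → ∀ y → ¬ Assigned (lits T) y →
                             ∀ d → d ∈ decs T → lvˡ d ≤ lv y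
    decision-lv≤unassigned (_▷_ {T} {e} v st) y ¬a d d∈ with ∈decs-∷ʳ⁻ {T} {e} d∈ | st
    ... | inj₁ m | _ = decision-lv≤unassigned v y (λ a → ¬a (Assigned-∷ʳ {T} {e} y a)) d m
    ... | inj₂ (here refl) | decision _ _ least _ = least y (λ a → ¬a (Assigned-∷ʳ {T} {e} y a))

    decisions-sorted-∷ʳ : ∀ {T} → CanonicalTrail T → ∀ d → ¬ Assigned (lits T) (var d) →
                          Linked _≤_ (map lvˡ (decs T ∷ʳ d))
    decisions-sorted-∷ʳ {T} v d ¬a =
      subst (Linked _≤_) (sym (map-++ lvˡ (decs T) (d ∷ [])))
        (Linked-∷ʳ (map lvˡ (decs T)) (lvˡ d) (decisions-sorted v) (All.tabulate below-d))
      where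
      below-d : ∀ {x} → x ∈ map lvˡ (decs T) → x ≤ lvˡ d
      below-d m with ∈-map⁻ lvˡ m
      ... | d' , d'∈ , refl = decision-lv≤unassigned v (var d) ¬a d' d'∈
      decisions-sorted : ∀ {T} → CanonicalTrail T → Linked _≤_ (map lvˡ (decs T))
      decisions-sorted [] = Linked.[]
      decisions-sorted (_▷_ {T} {dec d} v (decision .d ¬a _ _)) =
        subst (λ ds → Linked _≤_ (map lvˡ ds)) (sym (decs-∷ʳ T (dec d))) (decisions-sorted-∷ʳ v d ¬a)
      decisions-sorted (_▷_ {T} {prop p a} v _) =
        subst (λ ds → Linked _≤_ (map lvˡ ds)) (sym (trans (decs-∷ʳ T (prop p a)) (++-identityʳ (decs T))))
          (decisions-sorted v)

    unique-vars : ∀ {T} → CanonicalTrail T → Unique (map var (lits T))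
    unique-vars [] = AllPairs.[]
    unique-vars (_▷_ {T} {e} v st) =
      subst (λ σ → Unique (map var σ)) (sym (lits-∷ʳ T e))
        (subst Unique (sym (map-++ var (lits T) (entryLits e)))
          (AllPairsₚ.++⁺ (unique-vars v) (entry-unique e) (All.tabulate fresh)))
      where
      entry-unique : ∀ e → Unique (map var (entryLits e))
      entry-unique (dec _)      = [] AllPairs.∷ AllPairs.[]
      entry-unique (prop _ _)   = [] AllPairs.∷ AllPairs.[]
      entry-unique (conflict _) = AllPairs.[]
      fresh : ∀ {x} → x ∈ map var (lits T) → All (x ≢_) (map var (entryLits e))
      fresh m with ∈-map⁻ var m
      ... | l , l∈ , refl = All.tabulate λ m' eq → let k , k∈ , k≡ = ∈-map⁻ var m'
                                                   in step-unassigned st k k∈ (lose l∈ (trans eq k≡))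

    conflict-free : ∀ {T} → CanonicalTrail T → All NotConflict T
    conflict-free []                                 = []
    conflict-free (_▷_ {T} v (decision _ _ _ _))     = ∷ʳ⁺ (conflict-free v) tt
    conflict-free (_▷_ {T} v (propagation _ _ _ _ _ _)) = ∷ʳ⁺ (conflict-free v) tt

    everyPrefix-canonical : ∀ {T} → CanonicalTrail T → EveryPrefix (λ pre e → CanonicalTrail pre × Step pre e) T
    everyPrefix-canonical []                 = tt
    everyPrefix-canonical (_▷_ {T} {e} v st) = EveryPrefix-∷ʳ _ T e (everyPrefix-canonical v) (v , st)

    decision-follows-policy : ∀ P {pre d} → CanonicalTrail pre → Step pre (dec d) → PolicyOK P F pre d
    decision-follows-policy LEV-ORD v (decision d ¬a least _) x _ x∉ = least x (λ a → x∉ (Assigned⇒∈map a))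
    decision-follows-policy ASS-ORD v (decision d ¬a _ _) _ = decisions-sorted-∷ʳ v d ¬a
    decision-follows-policy ASS-R-ORD {pre} v (decision d ¬a least _) _ u ∀u u<d with Assigned? (lits pre) u
    ... | yes a    = let l , l∈ , l≡u = find a
                     in subst (_∈ map var (decs pre)) l≡u
                          (∈-map⁺ var (Universal⇒decision v l l∈ (subst Universal (sym l≡u) ∀u)))
    ... | no ¬a-u  = ⊥-elim (<⇒≱ u<d (least u ¬a-u))
    decision-follows-policy ANY-ORD v _ = tt

    NaturalNext : Trail n → Entry n → Set
    NaturalNext pre e = ((Σ (Clause n) λ C → (C ∈ F) × Unit R (lits pre) C) → IsPropagation e)
                      × ((Σ (Clause n) λ C → (C ∈ F) × UnitAs R (lits pre) C nothing) → IsConflict e)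

    step-admissible : ∀ P pre e → CanonicalTrail pre × Step pre e → EntryOK P R F pre e × NaturalNext pre e
    step-admissible P pre (dec d) (v , st@(decision .d _ _ noUnit)) =
      decision-follows-policy P v st , (λ u → ⊥-elim (noUnit u)) ,
      λ { (C , C∈F , u) → ⊥-elim (noUnit (C , C∈F , nothing , tt , u)) }
    step-admissible P pre (prop p a) (v , propagation .p .a a∈F ∃p u noEmpty) =
      (a∈F , ∃p , u) , (λ _ → tt) , (λ e → ⊥-elim (noEmpty e))

    canonical-conflict-trail : ∀ P {init a} → CanonicalTrail init → a ∈ F → UnitAs R (lits init) a nothing →
      ConflictTrail P R F (init ∷ʳ conflict a) × (∀ k → NaturalAt R F (init ∷ʳ conflict a) k)
    canonical-conflict-trail P {init} {a} v a∈F u =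
      ( (init , a , refl , conflict-free v)
      , subst (λ σ → Unique (map var σ)) (sym (trans (lits-∷ʳ init (conflict a)) (++-identityʳ (lits init))))
          (unique-vars v)
      , (λ k e rest eq → proj₁ (EveryPrefix-drop _ _ admissible k e rest eq)) )
      , (λ k e rest eq → proj₂ (EveryPrefix-drop _ _ admissible k e rest eq))
      where
      admissible : EveryPrefix (λ pre e → EntryOK P R F pre e × NaturalNext pre e) (init ∷ʳ conflict a)
      admissible = EveryPrefix-∷ʳ _ init (conflict a)
        (EveryPrefix-map init (step-admissible P) (everyPrefix-canonical v))
        ((a∈F , u) , (λ _ → tt) , (λ _ → tt))

  FreshExistential : List (Lit n) → Lit n → Set
  FreshExistential σ l = Existential (var l) × ¬ Assigned σ (var l)

  AddedTo : List (Lit n) → List (Lit n) → Lit n → Set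
  AddedTo σ σ' d = ∀ l → l ∈ σ' → (l ∈ σ) ⊎ ((l ≡ d) ⊎ FreshExistential σ l)

  unassigned : List (Lit n) → List (Fin n)
  unassigned σ = filter (λ y → ¬? (Assigned? σ y)) (allFin n)

  #unassigned : List (Lit n) → ℕ
  #unassigned σ = length (unassigned σ)

  least-unassigned : ∀ σ → (∀ y → Assigned σ y) ⊎
                     (Σ (Fin n) λ x → ¬ Assigned σ x × (∀ y → ¬ Assigned σ y → lv x ≤ lv y))
  least-unassigned σ with unassigned σ in eq | all-filter (λ y → ¬? (Assigned? σ y)) (allFin n)
  ... | [] | _ = inj₁ assigned
    where
    assigned : ∀ y → Assigned σ y
    assigned y with Assigned? σ y
    ... | yes a  = a
    ... | no ¬a  = ⊥-elim (¬Any[] (subst (y ∈_) eq (∈-filter⁺ (λ y → ¬? (Assigned? σ y)) (∈-allFin y) ¬a)))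
  ... | x ∷ xs | ¬a-x ∷ ¬a-xs =
    inj₂ (argmin lv x xs , argmin-all lv ¬a-x ¬a-xs ,
          λ y ¬a → least (subst (y ∈_) eq (∈-filter⁺ (λ y → ¬? (Assigned? σ y)) (∈-allFin y) ¬a)))
    where
    least : ∀ {y} → y ∈ x ∷ xs → lv (argmin lv x xs) ≤ lv y
    least (here refl) = f[argmin]≤f[⊤] {f = lv} x xs
    least (there y∈)  = All.lookup (f[argmin]≤f[xs] {f = lv} x xs) y∈

  #unassigned-<-∷ʳ : ∀ T e l → l ∈ entryLits e → ¬ Assigned (lits T) (var l) →
                     #unassigned (lits (T ∷ʳ e)) < #unassigned (lits T)
  #unassigned-<-∷ʳ T e l l∈ ¬a =
    length-filter-strictMono _ _ (λ y ¬a' a → ¬a' (Assigned-∷ʳ {T} {e} y a)) (allFin n) (var l) (∈-allFin (var l))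
      ¬a (λ ¬a' → ¬a' (∈⇒Assigned (∈lits-∷ʳ⁺ʳ {T} {e} l∈)))

  module Propagation (R : RedMode) (F : List (Clause n)) where
    open Canonical R F

    reduced-restriction : ∀ {σ C D x} → restrict C σ ≡ just D → UnitAs R σ C x → Reduce R D ≋ toClause x
    reduced-restriction {σ} {C} eq u with UnitAs⇒UnitAs′ R {σ} {C} u
    ... | D' , eq' , D'≋x with trans (sym eq) eq'
    ... | refl = D'≋x

    unit-candidate : Clause n → Maybe (Lit n)
    unit-candidate []      = nothing
    unit-candidate (h ∷ _) = just h

    ≋toClause⇒candidate : ∀ {D x} → D ≋ toClause x → x ≡ unit-candidate D
    ≋toClause⇒candidate {[]}    {nothing} _   = refl
    ≋toClause⇒candidate {[]}    {just p}  D≋p with Equivalence.from (D≋p p) (here refl)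
    ... | ()
    ≋toClause⇒candidate {h ∷ _} {nothing} D≋[] with Equivalence.to (D≋[] h) (here refl)
    ... | ()
    ≋toClause⇒candidate {h ∷ _} {just p}  D≋p = cong just (sym (singleton⁻ (Equivalence.to (D≋p h) (here refl))))

    ExistentialM? : ∀ x → Dec (ExistentialM x)
    ExistentialM? nothing  = yes tt
    ExistentialM? (just p) with T? (isE (var p))
    ... | yes isE-p = yes (isE⇒Existential (var p) isE-p)
    ... | no ¬isE-p = no (λ ∃p → ¬isE-p (Existential⇒isE (var p) ∃p))

    empty? : ∀ σ C → Dec (UnitAs R σ C nothing)
    empty? σ C with restrict C σ in eq
    ... | nothing = no λ u → let _ , eq' , _ = UnitAs⇒UnitAs′ R {σ} {C} u in contradiction (trans (sym eq) eq') λ ()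
    ... | just D with Reduce R D ≋? []
    ...   | yes D≋[] = yes (UnitAs′⇒UnitAs R {σ} {C} (D , eq , D≋[]))
    ...   | no ¬D≋[] = no λ u → ¬D≋[] (reduced-restriction eq u)

    unit? : ∀ σ C → Dec (Unit R σ C)
    unit? σ C with restrict C σ in eq
    ... | nothing = no λ (x , _ , u) → let _ , eq' , _ = UnitAs⇒UnitAs′ R {σ} {C} u
                                       in contradiction (trans (sym eq) eq') λ ()
    ... | just D with ExistentialM? (unit-candidate (Reduce R D)) | Reduce R D ≋? toClause (unit-candidate (Reduce R D))
    ...   | yes ∃x | yes D≋x = yes (_ , ∃x , UnitAs′⇒UnitAs R {σ} {C} (D , eq , D≋x))
    ...   | no ¬∃x | _       = no λ (x , ∃x , u) →
              ¬∃x (subst ExistentialM (≋toClause⇒candidate (reduced-restriction eq u)) ∃x)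
    ...   | _      | no ¬D≋x = no λ (x , _ , u) → let D≋x = reduced-restriction eq u in
              ¬D≋x (subst (λ y → Reduce R D ≋ toClause y) (≋toClause⇒candidate D≋x) D≋x)

    record Conflict : Set where
      field
        {init}     : Trail n
        {clause}   : Clause n
        canonical  : CanonicalTrail init
        clause∈F   : clause ∈ F
        falsified  : UnitAs R (lits init) clause nothing

    record Extension (T : Trail n) (extra : Lit n → Set) : Set where
      field
        trail       : Trail n
        canonical   : CanonicalTrail trail
        unit-free   : NoUnit trail
        extends     : ∀ l → l ∈ lits T → l ∈ lits trail
        added       : ∀ l → l ∈ lits trail → (l ∈ lits T) ⊎ extra l

    Propagated : Trail n → Set
    Propagated T = Σ (Extension T (FreshExistential (lits T))) λ E →
                   #unassigned (lits (Extension.trail E)) ≤ #unassigned (lits T)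

    Propagated-∷ʳ : ∀ T p a → Existential (var p) → ¬ Assigned (lits T) (var p) →
                    Propagated (T ∷ʳ prop p a) → Propagated T
    Propagated-∷ʳ T p a ∃p ¬a (E , fewer) =
      record { trail = trail ; canonical = canonical ; unit-free = unit-free
             ; extends = λ l m → extends l (∈lits-∷ʳ⁺ˡ {T} {prop p a} m) ; added = added′ } ,
      ≤-trans fewer (<⇒≤ (#unassigned-<-∷ʳ T (prop p a) p (here refl) ¬a))
      where
      open Extension E
      added′ : ∀ l → l ∈ lits trail → (l ∈ lits T) ⊎ FreshExistential (lits T) l
      added′ l m with added l m
      ... | inj₂ (∃l , ¬a-l) = inj₂ (∃l , λ as → ¬a-l (Assigned-∷ʳ {T} {prop p a} _ as))
      ... | inj₁ m′ with ∈lits-∷ʳ⁻ {T} {prop p a} m′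
      ...   | inj₁ m″         = inj₁ m″
      ...   | inj₂ (here refl) = inj₂ (∃p , ¬a)

    -- The bound is fuel: any strict upper bound on the number of unassigned variables.
    propagate : ∀ bound T → CanonicalTrail T → #unassigned (lits T) < bound → Conflict ⊎ Propagated T
    propagate (suc bound) T v lt with any? (empty? (lits T)) F
    ... | yes e = let C , C∈F , u = find e in inj₁ (record { canonical = v ; clause∈F = C∈F ; falsified = u })
    ... | no ¬e with any? (unit? (lits T)) F
    ...   | no ¬u = inj₂ (record { trail = T ; canonical = v ; unit-free = λ (C , C∈F , u) → ¬u (lose C∈F u)
                                 ; extends = λ _ m → m ; added = λ _ m → inj₁ m } , ≤-refl)
    ...   | yes u with find u
    ...     | C , C∈F , nothing , _ , e = inj₁ (record { canonical = v ; clause∈F = C∈F ; falsified = e })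
    ...     | C , C∈F , just p , ∃p , up =
      [ inj₁ , (λ P → inj₂ (Propagated-∷ʳ T p C ∃p ¬a P)) ]′
        (propagate bound (T ∷ʳ prop p C) (v ▷ propagation p C C∈F ∃p up λ (D , D∈F , e) → ¬e (lose D∈F e))
          (<-≤-trans (#unassigned-<-∷ʳ T (prop p C) p (here refl) ¬a) (≤-pred lt)))
      where
      ¬a : ¬ Assigned (lits T) (var p)
      ¬a = proj₂ (unit-literal-unassigned R {lits T} {C} up)

  AgreesOnBlock : List (Lit n) → ℕ → (Fin n → Bool) → Set
  AgreesOnBlock σ b β = ∀ l → l ∈ σ → lvˡ l ≡ b → β (var l) ≡ proj₂ l

  AgreesOutside : List (Lit n) → ℕ → (Fin n → Bool) → Set
  AgreesOutside σ k α = ∀ l → l ∈ σ → lvˡ l + k ≤ s → α (var l) ≡ proj₂ l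

  -- V on the last m blocks s ∸ m + 1, …, s, with both players bound to respect the partial assignment σ.
  ValueUnder : List (Clause n) → List (Lit n) → ℕ → (Fin n → Bool) → Set
  ValueUnder G σ zero    α = Sat G α
  ValueUnder G σ (suc m) α =
    QStep (q (s ∸ m)) (λ β → Agree (s ∸ m) α β × AgreesOnBlock σ (s ∸ m) β) (ValueUnder G σ m)

  ValueUnder-cong : ∀ G σ m {α α'} → (∀ x → α x ≡ α' x) → ValueUnder G σ m α → ValueUnder G σ m α'
  ValueUnder-cong G σ zero    α≗α' w = All.map (Any.map (trans (sym (α≗α' _)))) w
  ValueUnder-cong G σ (suc m) α≗α' w with q (s ∸ m)
  ... | ∃q = let β , (ag , on) , w′ = w in β , ((λ x ne → trans (sym (α≗α' x)) (ag x ne)) , on) , w′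
  ... | ∀q = λ β (ag , on) → w β ((λ x ne → trans (α≗α' x) (ag x ne)) , on)

  RelaxableTo : List (Lit n) → List (Lit n) → ℕ → Set
  RelaxableTo σ' σ m = ∀ l → l ∈ σ' → (l ∈ σ) ⊎ (Existential (var l) ⊎ (lvˡ l + m ≤ s))

  ValueUnder-relax : ∀ G σ σ' → (∀ l → l ∈ σ → l ∈ σ') → ∀ m → RelaxableTo σ' σ m →
                     ∀ α → ValueUnder G σ' m α → ValueUnder G σ m α
  ValueUnder-relax G σ σ' σ⊆σ' zero    _     α w = w
  ValueUnder-relax G σ σ' σ⊆σ' (suc m) relax α w with q (s ∸ m) in q≡
  ... | ∃q = let β , (ag , on) , w′ = w in
             β , (ag , λ l m′ → on l (σ⊆σ' l m′)) , ValueUnder-relax G σ σ' σ⊆σ' m relax′ β w′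
    where
    relax′ : RelaxableTo σ' σ m
    relax′ l m′ = Data.Sum.map₂ (Data.Sum.map₂ (≤-trans (+-monoʳ-≤ (lvˡ l) (n≤1+n m)))) (relax l m′)
  ... | ∀q = λ β (ag , on) → ValueUnder-relax G σ σ' σ⊆σ' m relax′ β (w β (ag , on′ on))
    where
    relax′ : RelaxableTo σ' σ m
    relax′ l m′ = Data.Sum.map₂ (Data.Sum.map₂ (≤-trans (+-monoʳ-≤ (lvˡ l) (n≤1+n m)))) (relax l m′)
    on′ : ∀ {β} → AgreesOnBlock σ (s ∸ m) β → AgreesOnBlock σ' (s ∸ m) β
    on′ on l m′ eq with relax l m′
    ... | inj₁ l∈σ         = on l l∈σ eq
    ... | inj₂ (inj₁ ∃l)   = ⊥-elim (¬Existential×Universal ∃l (trans (cong q eq) q≡))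
    ... | inj₂ (inj₂ le)   = ⊥-elim (≡∸⇒+suc≰ eq le)

  ValueUnder⇒V : ∀ G₀ G → (∀ C → C ∈ G₀ → C ∈ G) → ∀ σ → (∀ l → l ∈ σ → Existential (var l)) →
                 ∀ m α → ValueUnder G σ m α → V G₀ m α
  ValueUnder⇒V G₀ G G₀⊆G σ ∃σ zero    α w = All.tabulate (λ m → All.lookup w (G₀⊆G _ m))
  ValueUnder⇒V G₀ G G₀⊆G σ ∃σ (suc m) α w with q (s ∸ m) in q≡
  ... | ∃q = let β , (ag , _) , w′ = w in β , ag , ValueUnder⇒V G₀ G G₀⊆G σ ∃σ m β w′
  ... | ∀q = λ β ag → ValueUnder⇒V G₀ G G₀⊆G σ ∃σ m β
               (w β (ag , λ l m′ eq → ⊥-elim (¬Existential×Universal (∃σ l m′) (trans (cong q eq) q≡))))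

  -- σ₁ and σ₂ arise from σ by deciding the universal x (of least unassigned level) true,
  -- resp. false, and then propagating existential literals.
  module UniversalSplit (G : List (Clause n)) {σ σ₁ σ₂ : List (Lit n)} {x : Fin n} (∀x : Universal x)
    (σ⊆σ₁ : ∀ l → l ∈ σ → l ∈ σ₁) (σ⊆σ₂ : ∀ l → l ∈ σ → l ∈ σ₂)
    (added₁ : AddedTo σ σ₁ (x , true)) (added₂ : AddedTo σ σ₂ (x , false))
    (x-least : ∀ y → ¬ Assigned σ y → lv x ≤ lv y) where

    private
      1≤lv-x : 1 ≤ lv x
      1≤lv-x = proj₁ (lv-range x)

      outside-x-block : ∀ m b σᵢ → AddedTo σ σᵢ (x , b) → s < lv x + m → lv x ≢ s ∸ m →
                        ∀ {β} → AgreesOnBlock σ (s ∸ m) β → AgreesOnBlock σᵢ (s ∸ m) β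
      outside-x-block m b σᵢ added lt ne on l l∈ eq with added l l∈
      ... | inj₁ l∈σ             = on l l∈σ eq
      ... | inj₂ (inj₁ refl)     = ⊥-elim (ne eq)
      ... | inj₂ (inj₂ (_ , ¬a)) = ⊥-elim (<⇒≱ lt (≤∸⇒+≤ 1≤lv-x (subst (lv x ≤_) eq (x-least (var l) ¬a))))

      on-x-block : ∀ m b σᵢ → AddedTo σ σᵢ (x , b) → q (s ∸ m) ≡ ∀q →
                   ∀ {β} → β x ≡ b → AgreesOnBlock σ (s ∸ m) β → AgreesOnBlock σᵢ (s ∸ m) β
      on-x-block m b σᵢ added q≡ βx≡b on l l∈ eq with added l l∈
      ... | inj₁ l∈σ             = on l l∈σ eq
      ... | inj₂ (inj₁ refl)     = βx≡b
      ... | inj₂ (inj₂ (∃l , _)) = ⊥-elim (¬Existential×Universal ∃l (trans (cong q eq) q≡))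

      relaxable : ∀ m b σᵢ → AddedTo σ σᵢ (x , b) → lv x ≡ s ∸ m → RelaxableTo σᵢ σ m
      relaxable m b σᵢ added eq l l∈ with added l l∈
      ... | inj₁ l∈σ             = inj₁ l∈σ
      ... | inj₂ (inj₁ refl)     = inj₂ (inj₂ (≤∸⇒+≤ 1≤lv-x (≤-reflexive eq)))
      ... | inj₂ (inj₂ (∃l , _)) = inj₂ (inj₁ ∃l)

      all-assigned : ∀ m → s < lv x + m → ∀ y → lv y ≡ s ∸ m → Assigned σ y
      all-assigned m lt y eq with Assigned? σ y
      ... | yes a  = a
      ... | no ¬a  = ⊥-elim (<⇒≱ lt (≤∸⇒+≤ 1≤lv-x (subst (lv x ≤_) eq (x-least y ¬a))))

    split : ∀ m α → s < lv x + m → ValueUnder G σ₁ m α → ValueUnder G σ₂ m α → ValueUnder G σ m α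
    split zero α lt _ _ = ⊥-elim (<⇒≱ lt (subst (_≤ s) (sym (+-identityʳ (lv x))) (proj₂ (lv-range x))))
    split (suc m) α lt w₁ w₂ with lv x ≟ s ∸ m | q (s ∸ m) in q≡
    ... | yes eq | ∃q = ⊥-elim (¬Existential×Universal (trans (cong q eq) q≡) ∀x)
    ... | yes eq | ∀q = λ β (ag , on) → on-x β ag on
      where
      on-x : ∀ β → Agree (s ∸ m) α β → AgreesOnBlock σ (s ∸ m) β → ValueUnder G σ m β
      on-x β ag on with β x in βx
      ... | true  = ValueUnder-relax G σ σ₁ σ⊆σ₁ m (relaxable m true σ₁ added₁ eq) β
                      (w₁ β (ag , on-x-block m true σ₁ added₁ q≡ βx on))
      ... | false = ValueUnder-relax G σ σ₂ σ⊆σ₂ m (relaxable m false σ₂ added₂ eq) β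
                      (w₂ β (ag , on-x-block m false σ₂ added₂ q≡ βx on))
    ... | no ne | ∀q = λ β (ag , on) →
      split m β lt′ (w₁ β (ag , outside-x-block m true σ₁ added₁ lt′ ne on))
                    (w₂ β (ag , outside-x-block m false σ₂ added₂ lt′ ne on))
      where
      lt′ = <+suc⇒<+ lt ne
    -- On an existential block other than x's every variable is already assigned by σ, so both
    -- witnesses coincide and the two branches can be continued together.
    ... | no ne | ∃q =
      let β₁ , (ag₁ , on₁) , w₁′ = w₁
          β₂ , (ag₂ , on₂) , w₂′ = w₂
      in β₁ , (ag₁ , λ l l∈ → on₁ l (σ⊆σ₁ l l∈)) ,
         split m β₁ lt′ w₁′ (ValueUnder-cong G σ₂ m (β₂≗β₁ ag₁ ag₂ on₁ on₂) w₂′)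
      where
      lt′ = <+suc⇒<+ lt ne
      β₂≗β₁ : ∀ {β₁ β₂} → Agree (s ∸ m) α β₁ → Agree (s ∸ m) α β₂ →
              AgreesOnBlock σ₁ (s ∸ m) β₁ → AgreesOnBlock σ₂ (s ∸ m) β₂ → ∀ y → β₂ y ≡ β₁ y
      β₂≗β₁ ag₁ ag₂ on₁ on₂ y with lv y ≟ s ∸ m
      ... | no ne′ = trans (sym (ag₂ y ne′)) (ag₁ y ne′)
      ... | yes eq with find (all-assigned m lt′ y eq)
      ...   | l , l∈ , refl = trans (on₂ l (σ⊆σ₂ l l∈) eq) (sym (on₁ l (σ⊆σ₁ l l∈) eq))

  valuation : List (Lit n) → Fin n → Bool
  valuation []      y = false
  valuation (l ∷ σ) y with var l ≟F y
  ... | yes _ = proj₂ l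
  ... | no _  = valuation σ y

  valuation-∈ : ∀ σ → (∀ l → l ∈ σ → compl l ∉ σ) → ∀ l → l ∈ σ → valuation σ (var l) ≡ proj₂ l
  valuation-∈ (k ∷ σ) cons l l∈ with var k ≟F var l
  valuation-∈ (k ∷ σ) cons l l∈ | yes eq with same-var⇒≡⊎≡compl k l eq
  ... | inj₁ refl = refl
  ... | inj₂ refl = ⊥-elim (cons l l∈ (here refl))
  valuation-∈ (k ∷ σ) cons l (here refl) | no ne = ⊥-elim (ne refl)
  valuation-∈ (k ∷ σ) cons l (there l∈) | no ne = valuation-∈ σ (λ l a b → cons l (there a) (there b)) l l∈

  -- The existential player wins by playing the values of σ.
  module TotalAssignment (G : List (Clause n)) (σ : List (Lit n)) (cons : ∀ l → l ∈ σ → compl l ∉ σ)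
    (satisfies : ∀ α → (∀ l → l ∈ σ → α (var l) ≡ proj₂ l) → Sat G α) where

    private
      overwrite : (Fin n → Bool) → ℕ → Fin n → Bool
      overwrite α b y with lv y ≟ b
      ... | yes _ = valuation σ y
      ... | no _  = α y

    win : ∀ m α → AgreesOutside σ m α → ValueUnder G σ m α
    win zero α agrees =
      satisfies α (λ l l∈ → agrees l l∈ (subst (_≤ s) (sym (+-identityʳ _)) (proj₂ (lv-range (var l)))))
    win (suc m) α agrees with q (s ∸ m)
    ... | ∃q = β , (ag , on) , win m β agrees′
      where
      β = overwrite α (s ∸ m)
      ag : Agree (s ∸ m) α β
      ag y ne with lv y ≟ s ∸ m
      ... | yes eq = ⊥-elim (ne eq)
      ... | no _   = refl
      on : AgreesOnBlock σ (s ∸ m) β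
      on l l∈ eq with lv (var l) ≟ s ∸ m
      ... | yes _ = valuation-∈ σ cons l l∈
      ... | no ne = ⊥-elim (ne eq)
      agrees′ : AgreesOutside σ m β
      agrees′ l l∈ le with lv (var l) ≟ s ∸ m
      ... | yes _ = valuation-∈ σ cons l l∈
      ... | no ne = agrees l l∈ (+≤⇒+suc≤ le ne)
    ... | ∀q = λ β (ag , on) → win m β (agrees′ β ag on)
      where
      agrees′ : ∀ β → Agree (s ∸ m) α β → AgreesOnBlock σ (s ∸ m) β → AgreesOutside σ m β
      agrees′ β ag on l l∈ le with lv (var l) ≟ s ∸ m
      ... | yes eq = on l l∈ eq
      ... | no ne  = trans (sym (ag (var l) ne)) (agrees l l∈ (+≤⇒+suc≤ le ne))

  module Search (R : RedMode) (F : List (Clause n)) where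
    open Canonical R F
    open Propagation R F

    UnassignedInLast : List (Lit n) → ℕ → Set
    UnassignedInLast σ k = ∀ y → ¬ Assigned σ y → s < lv y + k

    Wins : List (Lit n) → ℕ → Set
    Wins σ k = ∀ α → AgreesOutside σ k α → ValueUnder F σ k α

    WinsBelow : Trail n → Set
    WinsBelow T = ∀ k → UnassignedInLast (lits T) k → Wins (lits T) k

    UnassignedInLast-mono : ∀ {σ σ'} → (∀ l → l ∈ σ → l ∈ σ') → ∀ k →
                            UnassignedInLast σ k → UnassignedInLast σ' k
    UnassignedInLast-mono σ⊆σ' k inLast y ¬a = inLast y (λ a → ¬a (Assigned-mono σ⊆σ' y a))

    AgreesOutside-added : ∀ {σ σ' x b} → AddedTo σ σ' (x , b) → ¬ Assigned σ x → ∀ k →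
                          UnassignedInLast σ k → ∀ α → AgreesOutside σ k α → AgreesOutside σ' k α
    AgreesOutside-added added ¬a-x k inLast α agrees l l∈ le with added l l∈
    ... | inj₁ l∈σ             = agrees l l∈σ le
    ... | inj₂ (inj₁ refl)     = ⊥-elim (<⇒≱ (inLast _ ¬a-x) le)
    ... | inj₂ (inj₂ (_ , ¬a)) = ⊥-elim (<⇒≱ (inLast (var l) ¬a) le)

    total-unit-free⇒Sat : ∀ T → NoUnit T → (∀ y → Assigned (lits T) y) →
                          ∀ α → (∀ l → l ∈ lits T → α (var l) ≡ proj₂ l) → Sat F α
    total-unit-free⇒Sat T noUnit total α agrees = All.tabulate (λ {C} → satisfied C)
      where
      σ = lits T
      satisfied : ∀ C → C ∈ F → Any (λ l → α (var l) ≡ proj₂ l) C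
      satisfied C C∈F with restrict C σ in eq
      ... | nothing = let l , l∈C , l∈σ = restrict≡nothing⇒satisfied C σ eq in lose l∈C (agrees l l∈σ)
      ... | just D  = ⊥-elim (noUnit (C , C∈F , nothing , tt , UnitAs′⇒UnitAs R {σ} {C} (D , eq , Reduce-D≋[])))
        where
        open Restriction (restrict≡just⇒Restriction C σ eq)
        D≡[] : D ≡ []
        D≡[] = ∀∉⇒≡[] D λ l l∈D → let l∈C , ¬f = ∈⇒∈C×¬falsified l l∈D
                                  in ¬Assigned l (unsatisfied l l∈C) ¬f (total (var l))
        Reduce-D≋[] : Reduce R D ≋ []
        Reduce-D≋[] = subst (λ D → Reduce R D ≋ []) (sym D≡[]) (subst (_≋ []) (sym (Reduce-[] R)) []≋[])

    wins-total : ∀ {T} → CanonicalTrail T → NoUnit T → (∀ y → Assigned (lits T) y) → WinsBelow T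
    wins-total {T} v noUnit total k _ =
      TotalAssignment.win F (lits T) (consistent v) (total-unit-free⇒Sat T noUnit total) k

    Branch : Trail n → Lit n → Set
    Branch T d = Σ (Extension T (λ l → (l ≡ d) ⊎ FreshExistential (lits T) l)) λ E →
                 #unassigned (lits (Extension.trail E)) < #unassigned (lits T)

    branch : ∀ {T} → CanonicalTrail T → NoUnit T → ∀ d → ¬ Assigned (lits T) (var d) →
             (∀ y → ¬ Assigned (lits T) y → lvˡ d ≤ lv y) → Conflict ⊎ Branch T d
    branch {T} v noUnit d ¬a least =
      Data.Sum.map₂ extend (propagate _ (T ∷ʳ dec d) (v ▷ decision d ¬a least noUnit) ≤-refl)
      where
      extend : Propagated (T ∷ʳ dec d) → Branch T d
      extend (E , fewer) =
        record { trail = trail ; canonical = canonical ; unit-free = unit-free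
               ; extends = λ l m → extends l (∈lits-∷ʳ⁺ˡ {T} {dec d} m) ; added = added′ } ,
        ≤-<-trans fewer (#unassigned-<-∷ʳ T (dec d) d (here refl) ¬a)
        where
        open Extension E
        added′ : AddedTo (lits T) (lits trail) d
        added′ l m with added l m
        ... | inj₂ (∃l , ¬a-l) = inj₂ (inj₂ (∃l , λ as → ¬a-l (Assigned-∷ʳ {T} {dec d} _ as)))
        ... | inj₁ m′ with ∈lits-∷ʳ⁻ {T} {dec d} m′
        ...   | inj₁ m″          = inj₁ m″
        ...   | inj₂ (here refl) = inj₂ (inj₁ refl)

    Explored : Trail n → Lit n → Set
    Explored T d = Σ (Branch T d) λ B → WinsBelow (Extension.trail (proj₁ B))

    wins-existential : ∀ {T x} → Existential x → ¬ Assigned (lits T) x → Explored T (x , true) → WinsBelow T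
    wins-existential {T} ∃x ¬a-x ((E , _) , wins) k inLast α agrees =
      ValueUnder-relax F (lits T) (lits trail) extends k relax α
        (wins k (UnassignedInLast-mono extends k inLast) α (AgreesOutside-added added ¬a-x k inLast α agrees))
      where
      open Extension E
      relax : RelaxableTo (lits trail) (lits T) k
      relax l m with added l m
      ... | inj₁ l∈              = inj₁ l∈
      ... | inj₂ (inj₁ refl)     = inj₂ (inj₁ ∃x)
      ... | inj₂ (inj₂ (∃l , _)) = inj₂ (inj₁ ∃l)

    wins-universal : ∀ {T x} → Universal x → ¬ Assigned (lits T) x → (∀ y → ¬ Assigned (lits T) y → lv x ≤ lv y) →
                     Explored T (x , true) → Explored T (x , false) → WinsBelow T
    wins-universal {T} ∀x ¬a-x least ((E₁ , _) , wins₁) ((E₂ , _) , wins₂) k inLast α agrees =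
      UniversalSplit.split F ∀x (Extension.extends E₁) (Extension.extends E₂) (Extension.added E₁) (Extension.added E₂)
        least k α (inLast _ ¬a-x) (explored E₁ wins₁) (explored E₂ wins₂)
      where
      explored : ∀ {b} (E : Extension T (λ l → (l ≡ (_ , b)) ⊎ FreshExistential (lits T) l)) →
                 WinsBelow (Extension.trail E) → ValueUnder F (lits (Extension.trail E)) k α
      explored E wins = wins k (UnassignedInLast-mono (Extension.extends E) k inLast) α
                          (AgreesOutside-added (Extension.added E) ¬a-x k inLast α agrees)

    search : ∀ bound T → CanonicalTrail T → NoUnit T → #unassigned (lits T) < bound → Conflict ⊎ WinsBelow T
    search (suc bound) T v noUnit lt with least-unassigned (lits T)
    ... | inj₁ total = inj₂ (wins-total v noUnit total)
    ... | inj₂ (x , ¬a-x , least) = by-quantifier (Existential⊎Universal x)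
      where
      explore : ∀ b → Conflict ⊎ Explored T (x , b)
      explore b with branch v noUnit (x , b) ¬a-x least
      ... | inj₁ c = inj₁ c
      ... | inj₂ B@(E , fewer) = Data.Sum.map₂ (B ,_)
              (search bound (Extension.trail E) (Extension.canonical E) (Extension.unit-free E) (<-≤-trans fewer (≤-pred lt)))
      by-quantifier : Existential x ⊎ Universal x → Conflict ⊎ WinsBelow T
      by-quantifier (inj₁ ∃x) = Data.Sum.map₂ (wins-existential ∃x ¬a-x) (explore true)
      by-quantifier (inj₂ ∀x) =
        [ inj₁ , (λ X₁ → Data.Sum.map₂ (wins-universal ∀x ¬a-x least X₁) (explore false)) ]′ (explore true)

  resolveWith : Entry n → Clause n → Clause n
  resolveWith (prop p a)   C = if elemᵇ (compl p) C then red (resolve p C (red a)) else C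
  resolveWith (dec _)      C = C
  resolveWith (conflict _) C = C

  resolveAll : Clause n → List (Entry n) → Clause n
  resolveAll C []       = C
  resolveAll C (e ∷ es) = resolveAll (resolveWith e C) es

  resolveToDecision : Clause n → List (Entry n) → Clause n
  resolveToDecision C []                = C
  resolveToDecision C (dec _ ∷ es)      = C
  resolveToDecision C (prop p a ∷ es)   = resolveToDecision (resolveWith (prop p a) C) es
  resolveToDecision C (conflict _ ∷ es) = resolveToDecision C es

  resolveAll-learnable : ∀ C es → resolveAll C es ∈ C ∷ learnFrom C es
  resolveAll-learnable C []                = here refl
  resolveAll-learnable C (dec _ ∷ es)      = resolveAll-learnable C es
  resolveAll-learnable C (conflict _ ∷ es) = resolveAll-learnable C es
  resolveAll-learnable C (prop p a ∷ es)   = there (resolveAll-learnable (resolveWith (prop p a) C) es)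

  resolveToDecision-learnable : ∀ C es → resolveToDecision C es ∈ C ∷ learnFrom C es
  resolveToDecision-learnable C []                = here refl
  resolveToDecision-learnable C (dec _ ∷ es)      = here refl
  resolveToDecision-learnable C (conflict _ ∷ es) = resolveToDecision-learnable C es
  resolveToDecision-learnable C (prop p a ∷ es)   = there (resolveToDecision-learnable (resolveWith (prop p a) C) es)

  Reduced : Clause n → Set
  Reduced C = Σ (Clause n) λ X → C ≡ red X

  resolveWith-Reduced : ∀ e C → Reduced C → Reduced (resolveWith e C)
  resolveWith-Reduced (dec _)      C r = r
  resolveWith-Reduced (conflict _) C r = r
  resolveWith-Reduced (prop p a)   C r with elemᵇ (compl p) C
  ... | true  = resolve p C (red a) , refl
  ... | false = r

  resolveAll-Reduced : ∀ C es → Reduced C → Reduced (resolveAll C es)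
  resolveAll-Reduced C []       r = r
  resolveAll-Reduced C (e ∷ es) r = resolveAll-Reduced (resolveWith e C) es (resolveWith-Reduced e C r)

  resolveToDecision-Reduced : ∀ C es → Reduced C → Reduced (resolveToDecision C es)
  resolveToDecision-Reduced C []                r = r
  resolveToDecision-Reduced C (dec _ ∷ es)      r = r
  resolveToDecision-Reduced C (conflict _ ∷ es) r = resolveToDecision-Reduced C es r
  resolveToDecision-Reduced C (prop p a ∷ es)   r =
    resolveToDecision-Reduced (resolveWith (prop p a) C) es (resolveWith-Reduced (prop p a) C r)

  private
    var≢ : ∀ p (l : Lit n) → T (not (var l ==V var p)) → var l ≢ var p
    var≢ p l t eq with var l ≟F var p
    ... | yes _ = t
    ... | no ne = ne eq

  ∈resolve⁻ : ∀ p C D {l} → l ∈ resolve p C D → ((l ∈ C) ⊎ (l ∈ D)) × (var l ≢ var p)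
  ∈resolve⁻ p C D {l} m with ∈-++⁻ (filterᵇ (λ l → not (var l ==V var p)) C) m
  ... | inj₁ m′ = let l∈C , t = ∈-filter⁻ (λ l → T? (not (var l ==V var p))) m′ in inj₁ l∈C , var≢ p l t
  ... | inj₂ m′ = let l∈D , t = ∈-filter⁻ (λ l → T? (not (var l ==V var p))) m′ in inj₂ l∈D , var≢ p l t

  falsified-unless-reduced : ∀ R {σ a x} → UnitAs R σ a x → ∀ l → l ∈ a → l ∉ toClause x →
                             (compl l ∈ σ) ⊎ (R ≡ RED × Universal (var l) × ¬ Assigned σ (var l))
  falsified-unless-reduced R {σ} {a} {x} u l l∈a l∉x with compl l ∈? σ | UnitAs⇒UnitAs′ R {σ} {a} u
  ... | yes f | _            = inj₁ f
  ... | no ¬f | D , eq , D≋x = unreduced R (Existential⊎Universal (var l)) D≋x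
    where
    open Restriction (restrict≡just⇒Restriction a σ eq)
    l∈D : l ∈ D
    l∈D = ¬falsified⇒∈ l l∈a ¬f
    unreduced : ∀ R → Existential (var l) ⊎ Universal (var l) → Reduce R D ≋ toClause x →
                (compl l ∈ σ) ⊎ (R ≡ RED × Universal (var l) × ¬ Assigned σ (var l))
    unreduced NO-RED _         D≋x = ⊥-elim (l∉x (Equivalence.to (D≋x l) l∈D))
    unreduced RED    (inj₁ ∃l) D≋x = ⊥-elim (l∉x (Equivalence.to (D≋x l) (∈⇒∈red l∈D ∃l)))
    unreduced RED    (inj₂ ∀l) _   = inj₂ (refl , ∀l , ¬Assigned l (unsatisfied l l∈a) ¬f)

  ∉[_] : ∀ {l p : Lit n} → var l ≢ var p → l ∉ toClause (just p)
  ∉[_] ne (here refl) = ne refl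

  resolveWith-preserves : ∀ (Extra : Lit n → Set) T p a C →
    (∀ l → l ∈ a → var l ≢ var p → (compl l ∈ lits T) ⊎ Extra l) →
    (∀ l → l ∈ C → (compl l ∈ lits (T ∷ʳ prop p a)) ⊎ Extra l) →
    ∀ l → l ∈ resolveWith (prop p a) C → (compl l ∈ lits T) ⊎ Extra l
  resolveWith-preserves Extra T p a C ante inv l l∈ with elemᵇ (compl p) C in ¬p∈C
  ... | true with ∈resolve⁻ p C (red a) (∈red⇒∈ {resolve p C (red a)} l∈)
  ...   | inj₂ l∈a , ne = ante l (∈red⇒∈ {a} l∈a) ne
  ...   | inj₁ l∈C , ne with inv l l∈C
  ...     | inj₂ x = inj₂ x
  ...     | inj₁ f with ∈lits-∷ʳ⁻ {T} {prop p a} f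
  ...       | inj₁ f′         = inj₁ f′
  ...       | inj₂ (here eq)  = ⊥-elim (ne (cong var eq))
  resolveWith-preserves Extra T p a C ante inv l l∈ | false with inv l l∈
  ... | inj₂ x = inj₂ x
  ... | inj₁ f with ∈lits-∷ʳ⁻ {T} {prop p a} f
  ...   | inj₁ f′        = inj₁ f′
  ...   | inj₂ (here eq) = ⊥-elim (not-¬ (∈⇒elemᵇ (compl p) C (subst (_∈ C) (compl≡⇒≡compl eq) l∈)) ¬p∈C)

  Learned : List (Clause n) → Trail n → Clause n → Set
  Learned F init a = Σ (Clause n) λ C → (C ∈ red a ∷ learnFrom (red a) (reverse init)) × ((C ≡ []) ⊎ New F C)

  module LearnNoRed (F : List (Clause n)) where
    open Canonical NO-RED F

    unit-others-falsified : ∀ {σ a x} → UnitAs NO-RED σ a x → ∀ l → l ∈ a → l ∉ toClause x → compl l ∈ σ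
    unit-others-falsified u l l∈a l∉x with falsified-unless-reduced NO-RED u l l∈a l∉x
    ... | inj₁ f = f

    resolveAll-negated-decisions : ∀ {T} → CanonicalTrail T → ∀ N → (∀ d → d ∈ decs T → d ∈ N) → ∀ C →
      (∀ l → l ∈ C → (compl l ∈ lits T) ⊎ (compl l ∈ N)) → ∀ l → l ∈ resolveAll C (reverse T) → compl l ∈ N
    resolveAll-negated-decisions [] N _ C inv l l∈ with inv l l∈
    ... | inj₂ x = x
    resolveAll-negated-decisions (_▷_ {T} {dec d} v _) N decs⊆N C inv l l∈ =
      resolveAll-negated-decisions v N (λ d′ m → decs⊆N d′ (∈decs-∷ʳ⁺ˡ {T} {dec d} m)) C inv′ l
        (subst (λ es → l ∈ resolveAll C es) (reverse-∷ʳ T (dec d)) l∈)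
      where
      inv′ : ∀ l → l ∈ C → (compl l ∈ lits T) ⊎ (compl l ∈ N)
      inv′ l m with inv l m
      ... | inj₂ x = inj₂ x
      ... | inj₁ f with ∈lits-∷ʳ⁻ {T} {dec d} f
      ...   | inj₁ f′          = inj₁ f′
      ...   | inj₂ (here refl) = inj₂ (decs⊆N _ (∈decs-∷ʳ⁺ʳ {T} {dec d} (here refl)))
    resolveAll-negated-decisions (_▷_ {T} {prop p a} v (propagation _ _ _ _ u _)) N decs⊆N C inv l l∈ =
      resolveAll-negated-decisions v N (λ d′ m → decs⊆N d′ (∈decs-∷ʳ⁺ˡ {T} {prop p a} m)) (resolveWith (prop p a) C)
        (resolveWith-preserves (λ l → compl l ∈ N) T p a C
           (λ l l∈a ne → inj₁ (unit-others-falsified u l l∈a ∉[ ne ])) inv) l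
        (subst (λ es → l ∈ resolveAll C es) (reverse-∷ʳ T (prop p a)) l∈)

    record Asserting (K : Clause n) : Set where
      field
        before    : Trail n
        decided   : Lit n
        canonical : CanonicalTrail before
        fresh     : ¬ Assigned (lits before) (var decided)
        unit-free : NoUnit before
        asserted  : compl decided ∈ K
        others    : ∀ l → l ∈ K → (compl l ∈ decs before) ⊎ (compl l ≡ decided)

    last-decision : ∀ {T} → CanonicalTrail T → ∀ K → (∀ l → l ∈ K → compl l ∈ decs T) →
                    (K ≡ []) ⊎ Asserting K
    last-decision [] K negated = inj₁ (∀∉⇒≡[] K (λ l l∈ → ¬Any[] (negated l l∈)))
    last-decision (_▷_ {T} {dec d} v (decision .d fresh _ unit-free)) K negated with compl d ∈? K
    ... | yes asserted = inj₂ (record { canonical = v ; fresh = fresh ; unit-free = unit-free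
                                      ; asserted = asserted ; others = others })
      where
      others : ∀ l → l ∈ K → (compl l ∈ decs T) ⊎ (compl l ≡ d)
      others l l∈ with ∈decs-∷ʳ⁻ {T} {dec d} (negated l l∈)
      ... | inj₁ c         = inj₁ c
      ... | inj₂ (here eq) = inj₂ eq
    ... | no ¬asserted = last-decision v K negated′
      where
      negated′ : ∀ l → l ∈ K → compl l ∈ decs T
      negated′ l l∈ with ∈decs-∷ʳ⁻ {T} {dec d} (negated l l∈)
      ... | inj₁ c         = c
      ... | inj₂ (here eq) = ⊥-elim (¬asserted (subst (_∈ K) (compl≡⇒≡compl eq) l∈))
    last-decision (_▷_ {T} {prop p a} v _) K negated = last-decision v K negated′
      where
      negated′ : ∀ l → l ∈ K → compl l ∈ decs T
      negated′ l l∈ with ∈decs-∷ʳ⁻ {T} {prop p a} (negated l l∈)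
      ... | inj₁ c = c

    module _ {K : Clause n} (A : Asserting K) (reduced : Reduced K) where
      open Asserting A

      -- A universal literal survives reduction only together with an existential literal of
      -- higher level, whose negation would be an earlier decision of higher level.
      asserted-Existential : Existential (var decided)
      asserted-Existential with Existential⊎Universal (var decided)
      ... | inj₁ ∃d = ∃d
      ... | inj₂ ∀d with ∈red-Universal⇒∃-above {proj₁ reduced} (subst (compl decided ∈_) (proj₂ reduced) asserted) ∀d
      ...   | x , x∈X , ∃x , d<x with others x (subst (x ∈_) (sym (proj₂ reduced)) (∈⇒∈red {proj₁ reduced} x∈X ∃x))
      ...     | inj₁ c  = ⊥-elim (<⇒≱ d<x (decision-lv≤unassigned canonical _ fresh (compl x) c))
      ...     | inj₂ eq = ⊥-elim (<-irrefl (cong lv (cong var (sym eq))) d<x)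

      Asserting⇒New : New F K
      Asserting⇒New D D∈F K≋D with restrict D (lits before) in eq
      ... | nothing = let l , l∈D , l∈σ = restrict≡nothing⇒satisfied D _ eq in
        [ (λ c → consistent canonical l l∈σ (decs⊆lits before c))
        , (λ c≡d → fresh (subst (Assigned (lits before)) (cong var c≡d) (∈⇒Assigned l∈σ))) ]′
        (others l (Equivalence.from (K≋D l) l∈D))
      ... | just D′ = unit-free (D , D∈F , just (compl decided) , asserted-Existential ,
                                 (D′ , eq , λ l → mk⇔ (λ l∈ → here (only l l∈)) λ { (here refl) → ¬d∈D′ }))
        where
        open Restriction (restrict≡just⇒Restriction D (lits before) eq)
        ¬d∈D′ : compl decided ∈ D′
        ¬d∈D′ = ¬falsified⇒∈ (compl decided) (Equivalence.to (K≋D _) asserted)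
                  (λ m → fresh (∈⇒Assigned (subst (_∈ lits before) (compl-involutive decided) m)))
        only : ∀ l → l ∈ D′ → l ≡ compl decided
        only l l∈ with ∈⇒∈C×¬falsified l l∈
        ... | l∈D , ¬f with others l (Equivalence.from (K≋D l) l∈D)
        ...   | inj₁ c   = ⊥-elim (¬f (decs⊆lits before c))
        ...   | inj₂ c≡d = compl≡⇒≡compl c≡d

  learnNoRed : ∀ F {init a} → Canonical.CanonicalTrail NO-RED F init → UnitAs NO-RED (lits init) a nothing → Learned F init a
  learnNoRed F {init} {a} v u = K , resolveAll-learnable (red a) (reverse init) , empty-or-new (last-decision v K negated)
    where
    open LearnNoRed F
    K = resolveAll (red a) (reverse init)
    negated : ∀ l → l ∈ K → compl l ∈ decs init
    negated = resolveAll-negated-decisions v (decs init) (λ _ m → m) (red a)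
                (λ l l∈ → inj₁ (unit-others-falsified u l (∈red⇒∈ {a} l∈) λ ()))
    empty-or-new : (K ≡ []) ⊎ Asserting K → (K ≡ []) ⊎ New F K
    empty-or-new = Data.Sum.map₂ (λ A → Asserting⇒New A (resolveAll-Reduced (red a) (reverse init) (a , refl)))

  module LearnRed (F : List (Clause n)) (init : Trail n) where
    open Canonical RED F

    OpenUniversal : Lit n → Set
    OpenUniversal l = Universal (var l) × ¬ Assigned (lits init) (var l)

    record Asserting (K : Clause n) : Set where
      field
        before         : Trail n
        decided        : Lit n
        canonical      : CanonicalTrail before
        fresh          : ¬ Assigned (lits before) (var decided)
        least          : ∀ y → ¬ Assigned (lits before) y → lvˡ decided ≤ lv y
        unit-free      : NoUnit before
        assigned-later : ∀ y → Assigned (lits before) y → Assigned (lits init) y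
        others         : ∀ l → l ∈ K → (compl l ∈ lits before) ⊎ ((compl l ≡ decided) ⊎ OpenUniversal l)

    Outcome : Clause n → Set
    Outcome K = (∀ l → l ∈ K → OpenUniversal l) ⊎ Asserting K

    -- Only the last decision level is resolved away, and it contains no universal propagations.
    resolveToDecision-outcome : ∀ {T} → CanonicalTrail T → (∀ y → Assigned (lits T) y → Assigned (lits init) y) →
      (∀ y → Universal y → ¬ Assigned (lits T) y → ¬ Assigned (lits init) y) → ∀ C →
      (∀ l → l ∈ C → (compl l ∈ lits T) ⊎ OpenUniversal l) → Outcome (resolveToDecision C (reverse T))
    resolveToDecision-outcome [] _ _ C inv = inj₁ λ l l∈ → [ (λ ()) , (λ o → o) ]′ (inv l l∈)
    resolveToDecision-outcome (_▷_ {T} {dec d} v (decision .d fresh least unit-free)) later open-later C inv =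
      subst (λ es → Outcome (resolveToDecision C es)) (sym (reverse-∷ʳ T (dec d)))
        (inj₂ (record { canonical = v ; fresh = fresh ; least = least ; unit-free = unit-free
                      ; assigned-later = λ y a → later y (Assigned-∷ʳ {T} {dec d} y a) ; others = others }))
      where
      others : ∀ l → l ∈ C → (compl l ∈ lits T) ⊎ ((compl l ≡ d) ⊎ OpenUniversal l)
      others l l∈ with inv l l∈
      ... | inj₂ o = inj₂ (inj₂ o)
      ... | inj₁ f with ∈lits-∷ʳ⁻ {T} {dec d} f
      ...   | inj₁ f′         = inj₁ f′
      ...   | inj₂ (here eq)  = inj₂ (inj₁ eq)
    resolveToDecision-outcome (_▷_ {T} {prop p a} v (propagation _ _ _ ∃p u _)) later open-later C inv =
      subst (λ es → Outcome (resolveToDecision C es)) (sym (reverse-∷ʳ T (prop p a)))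
        (resolveToDecision-outcome v (λ y as → later y (Assigned-∷ʳ {T} {prop p a} y as)) open-later′ (resolveWith (prop p a) C)
          (resolveWith-preserves OpenUniversal T p a C ante inv))
      where
      open-later′ : ∀ y → Universal y → ¬ Assigned (lits T) y → ¬ Assigned (lits init) y
      open-later′ y ∀y ¬a = open-later y ∀y λ a′ → let l , l∈ , l≡y = find a′ in
        [ (λ m → ¬a (lose m l≡y))
        , (λ { (here l≡p) → ¬Existential×Universal ∃p (subst Universal (trans (sym l≡y) (cong var l≡p)) ∀y) }) ]′
        (∈lits-∷ʳ⁻ {T} {prop p a} l∈)
      ante : ∀ l → l ∈ a → var l ≢ var p → (compl l ∈ lits T) ⊎ OpenUniversal l
      ante l l∈a ne with falsified-unless-reduced RED u l l∈a ∉[ ne ]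
      ... | inj₁ f                  = inj₁ f
      ... | inj₂ (_ , ∀l , ¬a-l)    = inj₂ (∀l , open-later′ (var l) ∀l ¬a-l)

    module _ {K : Clause n} (A : Asserting K) where
      open Asserting A

      ¬satisfied : ∀ D → K ≋ D → ∀ l → l ∈ D → l ∉ lits before
      ¬satisfied D K≋D l l∈D l∈σ with others l (Equivalence.from (K≋D l) l∈D)
      ... | inj₁ f              = consistent canonical l l∈σ f
      ... | inj₂ (inj₁ c≡d)     = fresh (subst (Assigned (lits before)) (cong var c≡d) (∈⇒Assigned l∈σ))
      ... | inj₂ (inj₂ (_ , ¬a)) = ¬a (assigned-later (var l) (∈⇒Assigned l∈σ))

      -- The restriction of D consists of the negated decision and universals of higher level, so
      -- D was unit or empty under reduction at the decision: impossible since the trail was unit-free.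
      Asserting⇒New : New F K
      Asserting⇒New D D∈F K≋D with restrict D (lits before) in eq
      ... | nothing = let l , l∈D , l∈σ = restrict≡nothing⇒satisfied D _ eq in ¬satisfied D K≋D l l∈D l∈σ
      ... | just D′ = by-cases (compl decided ∈? D′) (Existential⊎Universal (var decided))
        where
        open Restriction (restrict≡just⇒Restriction D (lits before) eq)
        restricted : ∀ l → l ∈ D′ → (l ≡ compl decided) ⊎ OpenUniversal l
        restricted l l∈ with ∈⇒∈C×¬falsified l l∈
        ... | l∈D , ¬f with others l (Equivalence.from (K≋D l) l∈D)
        ...   | inj₁ f          = ⊥-elim (¬f f)
        ...   | inj₂ (inj₁ c≡d) = inj₁ (compl≡⇒≡compl c≡d)
        ...   | inj₂ (inj₂ o)   = inj₂ o
        empty-unless : (compl decided ∈ D′ → ¬ Existential (var decided)) → ⊥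
        empty-unless bad = unit-free (D , D∈F , nothing , tt , (D′ , eq , subst (_≋ []) (sym red-D′≡[]) []≋[]))
          where
          red-D′≡[] : red D′ ≡ []
          red-D′≡[] = red≡[] D′ λ x x∈ ∃x →
            [ (λ { refl → bad x∈ ∃x }) , (λ (∀x , _) → ¬Existential×Universal ∃x ∀x) ]′
              (restricted x x∈)
        by-cases : Dec (compl decided ∈ D′) → Existential (var decided) ⊎ Universal (var decided) → ⊥
        by-cases (no ¬d∉) _          = empty-unless λ ¬d∈ → ⊥-elim (¬d∉ ¬d∈)
        by-cases (yes _) (inj₂ ∀d)   = empty-unless λ _ ∃d → ¬Existential×Universal ∃d ∀d
        by-cases (yes ¬d∈) (inj₁ ∃d) =
          unit-free (D , D∈F , just (compl decided) , ∃d , (D′ , eq , red≋[ compl decided ] ¬d∈ ∃d higher))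
          where
          higher : ∀ l → l ∈ D′ → (l ≡ compl decided) ⊎ (Universal (var l) × (lvˡ decided < lvˡ l))
          higher l l∈ = Data.Sum.map₂ (λ (∀l , ¬a) → ∀l , ≤∧≢⇒< (least (var l) (λ a → ¬a (assigned-later _ a)))
                                                                 (Existential-lv≢Universal-lv ∃d ∀l))
                          (restricted l l∈)

  learnRed : ∀ F {init a} → Canonical.CanonicalTrail RED F init → UnitAs RED (lits init) a nothing → Learned F init a
  learnRed F {init} {a} v u = K , resolveToDecision-learnable (red a) (reverse init) , empty-or-new outcome
    where
    open LearnRed F init
    K = resolveToDecision (red a) (reverse init)
    outcome : Outcome K
    outcome = resolveToDecision-outcome v (λ _ a → a) (λ _ _ ¬a → ¬a) (red a) λ l l∈ →
      Data.Sum.map₂ (λ (_ , ∀l , ¬a) → ∀l , ¬a) (falsified-unless-reduced RED u l (∈red⇒∈ {a} l∈) λ ())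
    empty-or-new : Outcome K → (K ≡ []) ⊎ New F K
    empty-or-new (inj₂ A)        = inj₂ (Asserting⇒New A)
    empty-or-new (inj₁ universal) with resolveToDecision-Reduced (red a) (reverse init) (a , refl)
    ... | X , K≡redX = inj₁ (trans K≡redX (red≡[] X λ x x∈X ∃x →
                         ¬Existential×Universal ∃x (proj₁ (universal x (subst (x ∈_) (sym K≡redX) (∈⇒∈red {X} x∈X ∃x))))))

  learn : ∀ R F {init a} → Canonical.CanonicalTrail R F init → UnitAs R (lits init) a nothing → Learned F init a
  learn RED    = learnRed
  learn NO-RED = learnNoRed

  module RefutationSearch (P : Policy) (R : RedMode) (F₀ : List (Clause n)) (F₀-false : ¬ V F₀ s (λ _ → false)) where

    -- With no conflict the search from the propagated root would yield a winning strategy for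
    -- the existential player on every clause set containing F₀.
    conflict-exists : ∀ F → (∀ C → C ∈ F₀ → C ∈ F) → Propagation.Conflict R F
    conflict-exists F F₀⊆F = [ (λ c → c) , from-root ]′ (propagate _ [] [] ≤-refl)
      where
      open Canonical R F
      open Propagation R F
      open Search R F
      from-root : Propagated [] → Conflict
      from-root (E , _) = [ (λ c → c) , (λ wins → ⊥-elim (F₀-false (true-at-root wins))) ]′
                            (search _ trail canonical unit-free ≤-refl)
        where
        open Extension E
        existential : ∀ l → l ∈ lits trail → Existential (var l)
        existential l l∈ with added l l∈
        ... | inj₂ (∃l , _) = ∃l
        true-at-root : WinsBelow trail → V F₀ s (λ _ → false)
        true-at-root wins = ValueUnder⇒V F₀ F F₀⊆F (lits trail) existential s (λ _ → false)
          (wins s (λ y _ → +-monoˡ-≤ s (proj₁ (lv-range y))) (λ _ → false)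
             λ l _ le → ⊥-elim (<⇒≱ (+-monoˡ-≤ s (proj₁ (lv-range (var l)))) le))

    Refutations : List (Clause n) → Maybe (Trail n) → Set
    Refutations F prev = Σ (List (Trail n × Clause n)) λ steps → Σ (Trail n) λ T →
                         ValidSteps P R F prev (steps ∷ʳ (T , []))

    -- Every trail is natural throughout, so it may always restart from the empty trail (k = 0).
    valid-step : ∀ F prev T C rest → ConflictTrail P R F T → Learnable T C → (∀ k → NaturalAt R F T k) →
                 ValidSteps P R (F ∷ʳ C) (just T) rest → ValidSteps P R F prev ((T , C) ∷ rest)
    valid-step F nothing   T C rest ct l natural vs = ct , l , natural , vs
    valid-step F (just T′) T C rest ct l natural vs = ct , l , (0 , z≤n , z≤n , refl , λ k _ → natural k) , vs

    refute : ∀ bound F → (∀ C → C ∈ F₀ → C ∈ F) → #unrepresented F < bound → ∀ prev → Refutations F prev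
    refute (suc bound) F F₀⊆F lt prev with conflict-exists F F₀⊆F
    ... | record { init = init ; clause = a ; canonical = v ; clause∈F = a∈F ; falsified = u }
        with learn R F v u | Canonical.canonical-conflict-trail R F P v a∈F u
    ...   | C , learnable , inj₁ refl | ct , natural =
            [] , init ∷ʳ conflict a , valid-step F prev _ [] [] ct (init , a , refl , learnable) natural tt
    ...   | C , learnable , inj₂ new  | ct , natural =
            let steps , T , vs = refute bound (F ∷ʳ C) (λ D m → ∈-++⁺ˡ (F₀⊆F D m))
                                   (<-≤-trans (#unrepresented-∷ʳ-New F C new) (≤-pred lt)) (just (init ∷ʳ conflict a))
            in (init ∷ʳ conflict a , C) ∷ steps , T , valid-step F prev _ C _ ct (init , a , refl , learnable) natural vs

theorem3p16 : (P : Policy) (R : RedMode) {n : ℕ} (Φ : QCNF n) → IsFalse Φ → Refutation P R Φ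
theorem3p16 P R Φ Φ-false = refute _ (QCNF.matrix Φ) (λ _ m → m) ≤-refl nothing
  where open Completeness.RefutationSearch (QCNF.prefix Φ) P R (QCNF.matrix Φ) Φ-false
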